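{- Let $p\ge 5$ be a prime of the form $p=24\ell+19$ with $\ell$ a nonnegative integer. Let $M(\mathbb{F}_p)=\{(x,y,z)\in\mathbb{F}_p^3 : x^2+y^2+z^2=xyz\}$ and $f_p=\phi_1\circ\phi_2$ on $M(\mathbb{F}_p)$, where $\phi_1(x,y,z)=(yz-x,y,z)$ and $\phi_2(x,y,z)=(x,xz-y,z)$. Let $\omega(p)$ be the smallest prime factor of $\frac{p^2-1}{24}$. Then every periodic point $P=(x,y,z)\in M(\mathbb{F}_p)$ of $f_p$ with $P\neq(0,0,0)$ and $z^2\neq 1$ in $\mathbb{F}_p$ has exact period at least $\omega(p)$.
   Context: For every prime $p\ge5$, $24$ divides $p^2-1$. A point $P$ has exact period $n$ if $f_p^n(P)=P$ and $f_p^m(P)\neq P$ for $1\le m<n$. -}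

module Defs where

open import Data.Nat using (ℕ; zero; suc; _+_; _*_; _∸_; _^_; _≤_; _<_; NonZero)
open import Data.Nat.DivMod using (_%_; _/_)
open import Data.Nat.Divisibility using (_∣_)
open import Data.Nat.Primality using (Prime)
open import Data.Product using (_×_; _,_)
open import Relation.Binary.PropositionalEquality using (_≡_)
open import Relation.Nullary using (¬_)

-- Elements of F_p are represented by their canonical residues: naturals x with x < p.
-- Arithmetic in F_p is ordinary ℕ arithmetic followed by reduction mod p.
-- Subtraction a - b in F_p is computed as (a + (p ∸ (b % p))) % p.

Point : Set
Point = ℕ × ℕ × ℕ

module _ (p : ℕ) .{{_ : NonZero p}} where

  _+ₚ_ : ℕ → ℕ → ℕ
  a +ₚ b = (a + b) % p

  _*ₚ_ : ℕ → ℕ → ℕ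
  a *ₚ b = (a * b) % p

  _-ₚ_ : ℕ → ℕ → ℕ
  a -ₚ b = (a + (p ∸ (b % p))) % p

  InF3 : Point → Set
  InF3 (x , y , z) = x < p × y < p × z < p

  InM : Point → Set
  InM (x , y , z) = InF3 (x , y , z) ×
    ((x * x + y * y + z * z) % p ≡ (x * y * z) % p)

  φ₁ : Point → Point
  φ₁ (x , y , z) = ((y *ₚ z) -ₚ x , y , z)

  φ₂ : Point → Point
  φ₂ (x , y , z) = (x , (x *ₚ z) -ₚ y , z)

  f : Point → Point
  f P = φ₁ (φ₂ P)

  fIter : ℕ → Point → Point
  fIter zero    P = P
  fIter (suc n) P = f (fIter n P)

  ExactPeriod : ℕ → Point → Set
  ExactPeriod n P = 1 ≤ n × fIter n P ≡ P ×
    (∀ m → 1 ≤ m → m < n → ¬ (fIter m P ≡ P))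

SmallestPrimeFactor : ℕ → ℕ → Set
SmallestPrimeFactor q n = Prime q × q ∣ n × (∀ r → Prime r → r ∣ n → q ≤ r)

-- Fix z and put t = z² − 2. For fixed z the map f_p is linear in (x , y), with a matrix T of
-- trace t and determinant 1, so the ring ℤ[ζ] = ℤ[X]/(X² − tX + 1) acts on pairs with ζ acting
-- as T, and f_p^N fixes P exactly when ζ^N fixes (x , y) modulo p. When t² − 4 is a unit mod p,
-- the Frobenius sends ζ to ζ or to ζ⁻¹ according to whether t² − 4 is a square (Euler's
-- criterion), so ζ^(p−1) = 1 or ζ^(p+1) = 1, and the exact period n of P divides
-- (p − 1)(p + 1) = 24 · (p² − 1)/24. If n were coprime to (p² − 1)/24 it would divide 24. But
-- ζ²⁴ fixes no nonzero pair: 2 − tr ζ²⁴ factors into t ± 2, t ± 1, t, t² − 3 and (t³ − 3t)² − 2,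
-- all nonzero because P ≠ 0, z² ≠ 1 and, for p ≡ 19 (mod 24), −1, 2 and 3 are nonresidues.
-- Hence n has a prime factor dividing (p² − 1)/24, which is at least ω.

module Submission where

open import Defs
open import Level using (0ℓ)
open import Algebra.Bundles using (Monoid; CommutativeRing)
open import Algebra.Definitions using (Congruent₁; Congruent₂)
open import Data.Empty using (⊥; ⊥-elim)
open import Data.Fin as Fin using (Fin; fromℕ; inject₁)
import Data.Fin.Properties as Fin
open import Data.Integer as ℤ using (ℤ)
open import Data.Integer.Divisibility.Signed as ℤ using (∣⇒∣ᵤ; ∣ᵤ⇒∣; ∣m∣n⇒∣m+n; ∣m⇒∣-m; ∣n⇒∣m*n)
open import Data.Integer.DivMod using (_%ℕ_; _/ℕ_; a≡a%ℕn+[a/ℕn]*n)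
import Data.Integer.Properties as ℤ
open import Data.Integer.Tactic.RingSolver using (solve-∀)
open import Data.List using ([]; _∷_)
open import Data.List.Relation.Unary.All using (_∷_)
open import Data.Nat as ℕ using (ℕ; zero; suc; NonZero; _≤_; _<_; s≤s; z≤n)
open import Data.Nat.Combinatorics using (_C_; nCk+nC[k+1]≡[n+1]C[k+1]; nC1≡n; nCn≡1)
open import Data.Nat.Coprimality using (gcd≡1⇒coprime; coprime-divisor)
open import Data.Nat.DivMod using (_%_; _/_; m≡m%n+[m/n]*n; m%n<n; m<n⇒m%n≡m; m*n/n≡m)
open import Data.Nat.Divisibility as ℕ using (_∣_; divides; ∣-trans; ∣⇒≤; m∣m*n; n∣m*n)
open import Data.Nat.GCD using (gcd; gcd[m,n]∣m; gcd[m,n]∣n; gcd[m,n]≡0⇒m≡0)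
open import Data.Nat.ListAction using (product)
open import Data.Nat.Primality using (Prime; euclidsLemma; prime⇒nonTrivial)
open import Data.Nat.Primality.Factorisation using (factorise)
import Data.Nat.Properties as ℕ
import Data.Nat.Tactic.RingSolver as ℕ-Solver
open import Data.Product using (Σ; _×_; _,_; proj₁; proj₂)
open import Data.Sum as Sum using (_⊎_; inj₁; inj₂; [_,_]′)
open import Function using (_∘_; id)
open import Relation.Binary.Core using (Rel; _⇒_)
open import Relation.Binary.Structures using (IsEquivalence)
open import Relation.Binary.PropositionalEquality as ≡ using (_≡_; cong₂)
open import Relation.Nullary using (¬_; contradiction)
open import Relation.Nullary.Decidable using (decidable-stable)

module _ {c ℓ} (R : CommutativeRing c ℓ) where
  open CommutativeRing R

  quotientCommutativeRing : ∀ {ℓ′} (_∼_ : Rel Carrier ℓ′) → IsEquivalence _∼_ → _≈_ ⇒ _∼_ →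
    Congruent₂ _∼_ _+_ → Congruent₂ _∼_ _*_ → Congruent₁ _∼_ (-_) → CommutativeRing c ℓ′
  quotientCommutativeRing _∼_ isEquivalence ≈⇒∼ +-cong′ *-cong′ -‿cong′ = record
    { Carrier = Carrier ; _≈_ = _∼_ ; _+_ = _+_ ; _*_ = _*_ ; -_ = -_ ; 0# = 0# ; 1# = 1#
    ; isCommutativeRing = record
      { isRing = record
        { +-isAbelianGroup = record
          { isGroup = record
            { isMonoid = record
              { isSemigroup = record
                { isMagma = record { isEquivalence = isEquivalence ; ∙-cong = +-cong′ }
                ; assoc = λ x y z → ≈⇒∼ (+-assoc x y z) }
              ; identity = ≈⇒∼ ∘ +-identityˡ , ≈⇒∼ ∘ +-identityʳ }
            ; inverse = ≈⇒∼ ∘ -‿inverseˡ , ≈⇒∼ ∘ -‿inverseʳ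
            ; ⁻¹-cong = -‿cong′ }
          ; comm = λ x y → ≈⇒∼ (+-comm x y) }
        ; *-cong = *-cong′
        ; *-assoc = λ x y z → ≈⇒∼ (*-assoc x y z)
        ; *-identity = ≈⇒∼ ∘ *-identityˡ , ≈⇒∼ ∘ *-identityʳ
        ; distrib = (λ x y z → ≈⇒∼ (distribˡ x y z)) , (λ x y z → ≈⇒∼ (distribʳ x y z)) }
      ; *-comm = λ x y → ≈⇒∼ (*-comm x y) } }


[1+k]*[1+n]C[1+k]≡[1+n]*nCk : ∀ n k → suc k ℕ.* (suc n C suc k) ≡ suc n ℕ.* (n C k)
[1+k]*[1+n]C[1+k]≡[1+n]*nCk zero    zero    = ≡.refl
[1+k]*[1+n]C[1+k]≡[1+n]*nCk zero    (suc k) = ℕ.*-zeroʳ (suc (suc k))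
[1+k]*[1+n]C[1+k]≡[1+n]*nCk (suc n) zero    =
  ≡.trans (ℕ.*-identityˡ _) (≡.trans (nC1≡n (suc (suc n))) (≡.sym (ℕ.*-identityʳ (suc (suc n)))))
[1+k]*[1+n]C[1+k]≡[1+n]*nCk (suc n) (suc k) = begin
  suc (suc k) ℕ.* (suc (suc n) C suc (suc k))
    ≡⟨ ≡.cong (suc (suc k) ℕ.*_) (nCk+nC[k+1]≡[n+1]C[k+1] (suc n) (suc k)) ⟨
  suc (suc k) ℕ.* (A ℕ.+ B)
    ≡⟨ ℕ.*-distribˡ-+ (suc (suc k)) A B ⟩
  (A ℕ.+ suc k ℕ.* A) ℕ.+ suc (suc k) ℕ.* B
    ≡⟨ ≡.cong₂ (λ u v → (A ℕ.+ u) ℕ.+ v) ([1+k]*[1+n]C[1+k]≡[1+n]*nCk n k)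
                                          ([1+k]*[1+n]C[1+k]≡[1+n]*nCk n (suc k)) ⟩
  (A ℕ.+ suc n ℕ.* (n C k)) ℕ.+ suc n ℕ.* (n C suc k)
    ≡⟨ ℕ.+-assoc A _ _ ⟩
  A ℕ.+ (suc n ℕ.* (n C k) ℕ.+ suc n ℕ.* (n C suc k))
    ≡⟨ ≡.cong (A ℕ.+_) (ℕ.*-distribˡ-+ (suc n) (n C k) (n C suc k)) ⟨
  A ℕ.+ suc n ℕ.* (n C k ℕ.+ n C suc k)
    ≡⟨ ≡.cong (λ u → A ℕ.+ suc n ℕ.* u) (nCk+nC[k+1]≡[n+1]C[k+1] n k) ⟩
  A ℕ.+ suc n ℕ.* A ∎
  where
  open ≡.≡-Reasoning
  A B : ℕ
  A = suc n C suc k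
  B = suc n C suc (suc k)

prime∣pCk : ∀ {p k} → Prime p → 0 < k → k < p → p ∣ p C k
prime∣pCk {suc n} {suc j} p-prime _ j<n
  with euclidsLemma (suc j) _ p-prime
         (divides (n C j) (≡.trans ([1+k]*[1+n]C[1+k]≡[1+n]*nCk n j) (ℕ.*-comm (suc n) _)))
... | inj₁ p∣1+j = contradiction (∣⇒≤ p∣1+j) (ℕ.<⇒≱ j<n)
... | inj₂ p∣pCk = p∣pCk

module _ {c ℓ} (M : Monoid c ℓ) where
  open Monoid M
  open import Algebra.Definitions.RawMonoid rawMonoid using () renaming (_×_ to _·_)

  ×-identity : ∀ n → n · ε ≈ ε
  ×-identity zero    = refl
  ×-identity (suc n) = trans (identityˡ _) (×-identity n)

module _ {c ℓ} (R : CommutativeRing c ℓ) where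
  open CommutativeRing R
  open import Algebra.Properties.Semiring.Exp semiring using (_^_; ^-congˡ; ^-congʳ; ^-homo-*; ^-assocʳ)
  open import Algebra.Properties.Monoid.Mult +-monoid using (×-assocˡ; ×-congʳ) renaming (_×_ to _·_)
  open import Algebra.Properties.Monoid.Sum +-monoid using (sum; sum-init-last; sum-cong-≋; sum-replicate-zero)
  import Algebra.Properties.CommutativeSemiring.Binomial commutativeSemiring as Binomial
  open import Relation.Binary.Reasoning.Setoid setoid

  frobenius : ∀ {p} → Prime p → (∀ x → p · x ≈ 0#) → ∀ x y → (x + y) ^ p ≈ x ^ p + y ^ p
  frobenius {suc n} p-prime char-p x y = begin
    (x + y) ^ suc n
      ≈⟨ Binomial.theorem (suc n) x y ⟩
    term Fin.zero + sum (term ∘ Fin.suc)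
      ≈⟨ +-congˡ (sum-init-last (term ∘ Fin.suc)) ⟩
    term Fin.zero + (sum (λ i → term (Fin.suc (inject₁ i))) + term (Fin.suc (fromℕ n)))
      ≈⟨ +-cong first (+-cong (trans (sum-cong-≋ middle) (sum-replicate-zero n)) last) ⟩
    y ^ suc n + (0# + x ^ suc n)
      ≈⟨ trans (+-congˡ (+-identityˡ _)) (+-comm _ _) ⟩
    x ^ suc n + y ^ suc n ∎
    where
    term : Fin (suc (suc n)) → Carrier
    term = Binomial.binomialTerm x y (suc n)
    first : term Fin.zero ≈ y ^ suc n
    first = trans (+-identityʳ _) (*-identityˡ _)
    last : term (Fin.suc (fromℕ n)) ≈ x ^ suc n
    last rewrite Fin.toℕ-fromℕ n | nCn≡1 (suc n) | ℕ.n∸n≡0 n = trans (+-identityʳ _) (*-identityʳ _)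
    multiple-vanishes : ∀ {m} w → suc n ∣ m → m · w ≈ 0#
    multiple-vanishes w (divides q ≡.refl) =
      trans (sym (×-assocˡ w q (suc n))) (trans (×-congʳ q (char-p w)) (×-identity +-monoid q))
    middle : ∀ (i : Fin n) → term (Fin.suc (inject₁ i)) ≈ 0#
    middle i rewrite Fin.toℕ-inject₁ i =
      multiple-vanishes _ (prime∣pCk p-prime (s≤s z≤n) (s≤s (Fin.toℕ<n i)))

  ^-periodic : ∀ {x} a q r → x ^ a ≈ 1# → x ^ (q ℕ.* a ℕ.+ r) ≈ x ^ r
  ^-periodic {x} a q r x^a≈1 = begin
    x ^ (q ℕ.* a ℕ.+ r)      ≈⟨ ^-homo-* x (q ℕ.* a) r ⟩
    x ^ (q ℕ.* a) * x ^ r    ≈⟨ *-congʳ (^-congʳ x (ℕ.*-comm q a)) ⟩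
    x ^ (a ℕ.* q) * x ^ r    ≈⟨ *-congʳ (^-assocʳ x a q) ⟨
    (x ^ a) ^ q * x ^ r      ≈⟨ *-congʳ (trans (^-congˡ q x^a≈1) (×-identity *-monoid q)) ⟩
    1# * x ^ r               ≈⟨ *-identityˡ (x ^ r) ⟩
    x ^ r                    ∎

∣-respʳ : ∀ {k a b} → a ≡ b → k ℤ.∣ a → k ℤ.∣ b
∣-respʳ ≡.refl k∣a = k∣a

module IntegersModPrime (p : ℕ) .{{_ : NonZero p}} (p-prime : Prime p) where
  open import Data.Integer using (+_; -_; _+_; _-_; _*_; _⊖_; ∣_∣)

  infix 4 p∣_ _≡ₚ_
  p∣_ : ℤ → Set
  p∣ a = + p ℤ.∣ a

  record _≡ₚ_ (a b : ℤ) : Set where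
    constructor mk≡ₚ
    field p∣difference : p∣ a - b
  open _≡ₚ_ public

  ≡⇒≡ₚ : ∀ {a b} → a ≡ b → a ≡ₚ b
  ≡⇒≡ₚ {a} ≡.refl = mk≡ₚ (ℤ.divides (+ 0) (ℤ.+-inverseʳ a))

  ≡ₚ-refl : ∀ {a} → a ≡ₚ a
  ≡ₚ-refl = ≡⇒≡ₚ ≡.refl

  ≡ₚ-sym : ∀ {a b} → a ≡ₚ b → b ≡ₚ a
  ≡ₚ-sym {a} {b} (mk≡ₚ d) = mk≡ₚ (∣-respʳ (lemma a b) (∣m⇒∣-m d))
    where lemma : ∀ a b → - (a - b) ≡ b - a
          lemma = solve-∀

  ≡ₚ-trans : ∀ {a b c} → a ≡ₚ b → b ≡ₚ c → a ≡ₚ c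
  ≡ₚ-trans {a} {b} {c} (mk≡ₚ d) (mk≡ₚ e) = mk≡ₚ (∣-respʳ (lemma a b c) (∣m∣n⇒∣m+n d e))
    where lemma : ∀ a b c → (a - b) + (b - c) ≡ a - c
          lemma = solve-∀

  ≡ₚ-isEquivalence : IsEquivalence _≡ₚ_
  ≡ₚ-isEquivalence = record { refl = ≡ₚ-refl ; sym = ≡ₚ-sym ; trans = ≡ₚ-trans }

  +-congₚ : ∀ {a a′ b b′} → a ≡ₚ a′ → b ≡ₚ b′ → a + b ≡ₚ a′ + b′
  +-congₚ {a} {a′} {b} {b′} (mk≡ₚ d) (mk≡ₚ e) = mk≡ₚ (∣-respʳ (lemma a a′ b b′) (∣m∣n⇒∣m+n d e))
    where lemma : ∀ a a′ b b′ → (a - a′) + (b - b′) ≡ (a + b) - (a′ + b′)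
          lemma = solve-∀

  neg-congₚ : ∀ {a a′} → a ≡ₚ a′ → - a ≡ₚ - a′
  neg-congₚ {a} {a′} (mk≡ₚ d) = mk≡ₚ (∣-respʳ (lemma a a′) (∣m⇒∣-m d))
    where lemma : ∀ a a′ → - (a - a′) ≡ - a - - a′
          lemma = solve-∀

  minus-congₚ : ∀ {a a′ b b′} → a ≡ₚ a′ → b ≡ₚ b′ → a - b ≡ₚ a′ - b′
  minus-congₚ a≡a′ b≡b′ = +-congₚ a≡a′ (neg-congₚ b≡b′)

  *-congₚ : ∀ {a a′ b b′} → a ≡ₚ a′ → b ≡ₚ b′ → a * b ≡ₚ a′ * b′
  *-congₚ {a} {a′} {b} {b′} (mk≡ₚ d) (mk≡ₚ e) =
    mk≡ₚ (∣-respʳ (lemma a a′ b b′) (∣m∣n⇒∣m+n (∣n⇒∣m*n b d) (∣n⇒∣m*n a′ e)))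
    where lemma : ∀ a a′ b b′ → b * (a - a′) + a′ * (b - b′) ≡ a * b - a′ * b′
          lemma = solve-∀

  ℤₚ : CommutativeRing _ _
  ℤₚ = quotientCommutativeRing ℤ.+-*-commutativeRing _≡ₚ_ ≡ₚ-isEquivalence ≡⇒≡ₚ
         +-congₚ *-congₚ neg-congₚ

  open CommutativeRing ℤₚ using (+-rawMonoid; *-monoid; semiring; commutativeSemiring)
  open import Algebra.Definitions.RawMonoid +-rawMonoid using () renaming (_×_ to _·_)
  open import Algebra.Properties.Semiring.Exp semiring public using (_^_; ^-congˡ; ^-congʳ; ^-homo-*)
  open import Algebra.Properties.CommutativeSemiring.Exp commutativeSemiring public using (^-distrib-*)
  open import Relation.Binary.Reasoning.Setoid (CommutativeRing.setoid ℤₚ)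

  p∣⇒≡ₚ0 : ∀ {a} → p∣ a → a ≡ₚ + 0
  p∣⇒≡ₚ0 {a} = mk≡ₚ ∘ ∣-respʳ (≡.sym (ℤ.+-identityʳ a))

  euclidsLemmaₚ : ∀ a b → p∣ a * b → p∣ a ⊎ p∣ b
  euclidsLemmaₚ a b p∣ab =
    Sum.map ∣ᵤ⇒∣ ∣ᵤ⇒∣ (euclidsLemma ∣ a ∣ ∣ b ∣ p-prime (≡.subst (p ℕ.∣_) (ℤ.abs-* a b) (∣⇒∣ᵤ p∣ab)))

  p∣square⇒p∣ : ∀ a → p∣ a * a → p∣ a
  p∣square⇒p∣ a p∣aa = [ id , id ]′ (euclidsLemmaₚ a a p∣aa)

  p∤-small : ∀ {n} → 0 < n → n < p → ¬ p∣ + n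
  p∤-small {suc n} _ n<p p∣n = ℕ.>⇒∤ n<p (∣⇒∣ᵤ p∣n)

  p∤-below : ∀ {n b} → b ℕ.≤ p → 0 < n → n < b → ¬ p∣ + n
  p∤-below b≤p 0<n n<b = p∤-small 0<n (ℕ.<-≤-trans n<b b≤p)

  ≡ₚ⇒≡ : ∀ {a b} → a < p → b < p → + a ≡ₚ + b → a ≡ b
  ≡ₚ⇒≡ {a} {b} a<p b<p (mk≡ₚ d) =
    ℤ.+-injective (ℤ.i-j≡0⇒i≡j (+ a) (+ b) (ℤ.∣i∣≡0⇒i≡0 ∣a-b∣≡0))
    where
    ∣a-b∣<p : ∣ + a - + b ∣ < p
    ∣a-b∣<p = ≡.subst (_< p) (≡.cong ∣_∣ (≡.sym (ℤ.m-n≡m⊖n a b)))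
                (ℕ.≤-<-trans (ℤ.∣m⊝n∣≤m⊔n a b) (ℕ.⊔-lub a<p b<p))
    ∣a-b∣≡0 : ∣ + a - + b ∣ ≡ 0
    ∣a-b∣≡0 = ≡.trans (≡.sym (m<n⇒m%n≡m ∣a-b∣<p)) (ℕ.n∣m⇒m%n≡0 _ p (∣⇒∣ᵤ d))

  %-≡ₚ : ∀ a → + (a % p) ≡ₚ + a
  %-≡ₚ a = mk≡ₚ (ℤ.divides (- + (a / p))
    (≡.trans (≡.cong (λ u → + (a % p) - u) a≡) (lemma (+ (a % p)) (+ (a / p)) (+ p))))
    where
    a≡ : + a ≡ + (a % p) + + (a / p) * + p
    a≡ = ≡.trans (≡.cong +_ (m≡m%n+[m/n]*n a p))
           (≡.trans (ℤ.pos-+ (a % p) _) (≡.cong (λ u → + (a % p) + u) (ℤ.pos-* (a / p) p)))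
    lemma : ∀ r q p → r - (r + q * p) ≡ (- q) * p
    lemma = solve-∀

  %ℕ-≡ₚ : ∀ a → a ≡ₚ + (a %ℕ p)
  %ℕ-≡ₚ a = mk≡ₚ (ℤ.divides (a /ℕ p)
    (≡.trans (≡.cong (_- + (a %ℕ p)) (a≡a%ℕn+[a/ℕn]*n a p)) (lemma (+ (a %ℕ p)) (a /ℕ p) (+ p))))
    where lemma : ∀ r q p → r + q * p - r ≡ q * p
          lemma = solve-∀

  %-*-≡ₚ : ∀ a b → + ((a ℕ.* b) % p) ≡ₚ + a * + b
  %-*-≡ₚ a b = ≡ₚ-trans (%-≡ₚ (a ℕ.* b)) (≡⇒≡ₚ (ℤ.pos-* a b))

  %-minus-≡ₚ : ∀ a b → + ((a ℕ.+ (p ℕ.∸ b % p)) % p) ≡ₚ + a - + b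
  %-minus-≡ₚ a b = begin
    + ((a ℕ.+ (p ℕ.∸ b % p)) % p)   ≈⟨ %-≡ₚ _ ⟩
    + (a ℕ.+ (p ℕ.∸ b % p))         ≡⟨ ℤ.pos-+ a _ ⟩
    + a + + (p ℕ.∸ b % p)           ≡⟨ ≡.cong (λ u → + a + u) (ℤ.⊖-≥ (ℕ.<⇒≤ (m%n<n b p))) ⟨
    + a + (p ⊖ b % p)               ≡⟨ ≡.cong (λ u → + a + u) (ℤ.m-n≡m⊖n p (b % p)) ⟨
    + a + (+ p - + (b % p))         ≈⟨ +-congₚ (≡ₚ-refl {+ a}) p-b%p≡-b ⟩
    + a - + b                       ∎
    where
    lemma : ∀ p r b → p + - (r - b) ≡ (p - r) - - b
    lemma = solve-∀
    p-b%p≡-b : + p - + (b % p) ≡ₚ - + b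
    p-b%p≡-b = mk≡ₚ (∣-respʳ (lemma (+ p) (+ (b % p)) (+ b))
                               (∣m∣n⇒∣m+n ℤ.∣-refl (∣m⇒∣-m (p∣difference (%-≡ₚ b)))))

  p∤-cancelˡ : ∀ {c a b} → ¬ p∣ c → c * a ≡ₚ c * b → a ≡ₚ b
  p∤-cancelˡ {c} {a} {b} p∤c (mk≡ₚ d) =
    [ ⊥-elim ∘ p∤c , mk≡ₚ ]′ (euclidsLemmaₚ c (a - b) (∣-respʳ (lemma c a b) d))
    where lemma : ∀ c a b → c * a - c * b ≡ c * (a - b)
          lemma = solve-∀

  -1≢ₚ1 : ¬ p∣ + 2 → ¬ - + 1 ≡ₚ + 1
  -1≢ₚ1 p∤2 -1≡1 = p∤2 (∣m⇒∣-m (p∣difference -1≡1))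

  square≡1⇒≡±1 : ∀ {a} → a * a ≡ₚ + 1 → a ≡ₚ + 1 ⊎ a ≡ₚ - + 1
  square≡1⇒≡±1 {a} (mk≡ₚ d) = Sum.map mk≡ₚ (mk≡ₚ ∘ ∣-respʳ (lemma₂ a))
    (euclidsLemmaₚ (a - + 1) (a + + 1) (∣-respʳ (lemma₁ a) d))
    where
    lemma₁ : ∀ a → a * a - + 1 ≡ (a - + 1) * (a + + 1)
    lemma₁ = solve-∀
    lemma₂ : ∀ a → a + + 1 ≡ a - - + 1
    lemma₂ = solve-∀

  ·≡* : ∀ n a → n · a ≡ + n * a
  ·≡* zero    a = ≡.refl
  ·≡* (suc n) a =
    ≡.trans (≡.cong (_+_ a) (·≡* n a)) (≡.trans (lemma (+ n) a) (≡.cong (_* a) (≡.sym (ℤ.pos-+ 1 n))))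
    where lemma : ∀ n a → a + n * a ≡ (+ 1 + n) * a
          lemma = solve-∀

  characteristic : ∀ a → p · a ≡ₚ + 0
  characteristic a = p∣⇒≡ₚ0 (ℤ.divides a (≡.trans (·≡* p a) (ℤ.*-comm (+ p) a)))

  fermat : ∀ a → a ^ p ≡ₚ a
  fermat a = begin
    a ^ p                ≈⟨ ^-congˡ p (%ℕ-≡ₚ a) ⟩
    (+ (a %ℕ p)) ^ p     ≈⟨ fermat-ℕ (a %ℕ p) ⟩
    + (a %ℕ p)           ≈⟨ %ℕ-≡ₚ a ⟨
    a                    ∎
    where
    0^p≡0 : ∀ {m} → p ≡ m → (+ 0) ^ m ≡ₚ + 0
    0^p≡0 {zero}  p≡0 = contradiction p≡0 (ℕ.≢-nonZero⁻¹ p)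
    0^p≡0 {suc m} _   = ≡ₚ-refl
    fermat-ℕ : ∀ n → (+ n) ^ p ≡ₚ + n
    fermat-ℕ zero    = 0^p≡0 ≡.refl
    fermat-ℕ (suc n) = begin
      (+ suc n) ^ p             ≡⟨ ≡.cong (_^ p) (ℤ.pos-+ 1 n) ⟩
      (+ 1 + + n) ^ p           ≈⟨ frobenius ℤₚ p-prime characteristic (+ 1) (+ n) ⟩
      (+ 1) ^ p + (+ n) ^ p     ≈⟨ +-congₚ (×-identity *-monoid p) (fermat-ℕ n) ⟩
      + 1 + + n                 ≡⟨ ℤ.pos-+ 1 n ⟨
      + suc n                   ∎

  module _ {k} (p≡2k+1 : p ≡ suc (k ℕ.+ k)) where

    fermat-unit : ∀ {a} → ¬ p∣ a → a ^ (k ℕ.+ k) ≡ₚ + 1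
    fermat-unit {a} p∤a = p∤-cancelˡ p∤a (begin
      a * a ^ (k ℕ.+ k)   ≈⟨ ^-congʳ a p≡2k+1 ⟨
      a ^ p               ≈⟨ fermat a ⟩
      a                   ≡⟨ ℤ.*-identityʳ a ⟨
      a * + 1             ∎)

    euler : ∀ {a} → ¬ p∣ a → a ^ k ≡ₚ + 1 ⊎ a ^ k ≡ₚ - + 1
    euler {a} p∤a = square≡1⇒≡±1 (≡ₚ-trans (≡ₚ-sym (^-homo-* a k k)) (fermat-unit p∤a))

  p∤⇒invertible : ∀ {b} → ¬ p∣ b → Σ ℤ λ u → b * u ≡ₚ + 1
  p∤⇒invertible {b} p∤b = invert ≡.refl (ℕ.nonTrivial⇒n>1 p {{prime⇒nonTrivial p-prime}})
    where
    invert : ∀ {m} → p ≡ m → 1 < m → Σ ℤ λ u → b * u ≡ₚ + 1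
    invert {suc zero}    _      (s≤s ())
    invert {suc (suc n)} p≡2+n  _ = b ^ n , p∤-cancelˡ p∤b (begin
      b * (b * b ^ n)   ≈⟨ ^-congʳ b p≡2+n ⟨
      b ^ p             ≈⟨ fermat b ⟩
      b                 ≡⟨ ℤ.*-identityʳ b ⟨
      b * + 1           ∎)

-- (a , b) stands for a + bζ with ζ² = tζ − 1; its conjugate ζ̄ = t − ζ is ζ⁻¹.
module Quadratic (t : ℤ) where
  open import Data.Integer using (+_; -_; _+_; _-_; _*_)


  infixl 6 _⊕_
  infixl 7 _⊗_

  _⊕_ : ℤ × ℤ → ℤ × ℤ → ℤ × ℤ
  (a , b) ⊕ (c , d) = (a + c , b + d)

  ⊝_ : ℤ × ℤ → ℤ × ℤ
  ⊝ (a , b) = (- a , - b)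

  -- Opaque because unfolding products of concrete pairs makes unification very slow.
  opaque
    _⊗_ : ℤ × ℤ → ℤ × ℤ → ℤ × ℤ
    (a , b) ⊗ (c , d) = (a * c - b * d , a * d + b * c + t * (b * d))

    ⊗-def : ∀ a b c d → (a , b) ⊗ (c , d) ≡ (a * c - b * d , a * d + b * c + t * (b * d))
    ⊗-def _ _ _ _ = ≡.refl

  ι : ℤ → ℤ × ℤ
  ι a = (a , + 0)

  ζ ζ̄ : ℤ × ℤ
  ζ = (+ 0 , + 1)
  ζ̄ = (t , - + 1)

  opaque
    unfolding _⊗_

    ⊗-assoc : ∀ x y z → (x ⊗ y) ⊗ z ≡ x ⊗ (y ⊗ z)
    ⊗-assoc (a , b) (c , d) (e , f) = cong₂ _,_ (lemma₁ a b c d e f t) (lemma₂ a b c d e f t)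
      where
      lemma₁ : ∀ a b c d e f t → (a * c - b * d) * e - (a * d + b * c + t * (b * d)) * f ≡
                                 a * (c * e - d * f) - b * (c * f + d * e + t * (d * f))
      lemma₁ = solve-∀
      lemma₂ : ∀ a b c d e f t →
        (a * c - b * d) * f + (a * d + b * c + t * (b * d)) * e + t * ((a * d + b * c + t * (b * d)) * f) ≡
        a * (c * f + d * e + t * (d * f)) + b * (c * e - d * f) + t * (b * (c * f + d * e + t * (d * f)))
      lemma₂ = solve-∀

    ⊗-comm : ∀ x y → x ⊗ y ≡ y ⊗ x
    ⊗-comm (a , b) (c , d) = cong₂ _,_ (lemma₁ a b c d) (lemma₂ a b c d t)
      where
      lemma₁ : ∀ a b c d → a * c - b * d ≡ c * a - d * b
      lemma₁ = solve-∀
      lemma₂ : ∀ a b c d t → a * d + b * c + t * (b * d) ≡ c * b + d * a + t * (d * b)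
      lemma₂ = solve-∀

    ⊗-identityˡ : ∀ x → ι (+ 1) ⊗ x ≡ x
    ⊗-identityˡ (a , b) = cong₂ _,_ (lemma₁ a b) (lemma₂ a b t)
      where
      lemma₁ : ∀ a b → + 1 * a - + 0 * b ≡ a
      lemma₁ = solve-∀
      lemma₂ : ∀ a b t → + 1 * b + + 0 * a + t * (+ 0 * b) ≡ b
      lemma₂ = solve-∀

    ⊗-distribʳ : ∀ x y z → (y ⊕ z) ⊗ x ≡ (y ⊗ x) ⊕ (z ⊗ x)
    ⊗-distribʳ (a , b) (c , d) (e , f) = cong₂ _,_ (lemma₁ a b c d e f) (lemma₂ a b c d e f t)
      where
      lemma₁ : ∀ a b c d e f → (c + e) * a - (d + f) * b ≡ (c * a - d * b) + (e * a - f * b)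
      lemma₁ = solve-∀
      lemma₂ : ∀ a b c d e f t → (c + e) * b + (d + f) * a + t * ((d + f) * b) ≡
                                  (c * b + d * a + t * (d * b)) + (e * b + f * a + t * (f * b))
      lemma₂ = solve-∀

  ⊗-distribˡ : ∀ x y z → x ⊗ (y ⊕ z) ≡ (x ⊗ y) ⊕ (x ⊗ z)
  ⊗-distribˡ x y z =
    ≡.trans (⊗-comm x (y ⊕ z)) (≡.trans (⊗-distribʳ x y z) (cong₂ _⊕_ (⊗-comm y x) (⊗-comm z x)))

  ℤ[ζ] : CommutativeRing 0ℓ 0ℓ
  ℤ[ζ] = record
    { Carrier = ℤ × ℤ ; _≈_ = _≡_ ; _+_ = _⊕_ ; _*_ = _⊗_ ; -_ = ⊝_ ; 0# = ι (+ 0) ; 1# = ι (+ 1)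
    ; isCommutativeRing = record
      { isRing = record
        { +-isAbelianGroup = record
          { isGroup = record
            { isMonoid = record
              { isSemigroup = record
                { isMagma = record { isEquivalence = ≡.isEquivalence ; ∙-cong = cong₂ _⊕_ }
                ; assoc = λ where (a , b) (c , d) (e , f) → cong₂ _,_ (ℤ.+-assoc a c e) (ℤ.+-assoc b d f) }
              ; identity = (λ where (a , b) → cong₂ _,_ (ℤ.+-identityˡ a) (ℤ.+-identityˡ b))
                         , (λ where (a , b) → cong₂ _,_ (ℤ.+-identityʳ a) (ℤ.+-identityʳ b)) }
            ; inverse = (λ where (a , b) → cong₂ _,_ (ℤ.+-inverseˡ a) (ℤ.+-inverseˡ b))
                      , (λ where (a , b) → cong₂ _,_ (ℤ.+-inverseʳ a) (ℤ.+-inverseʳ b))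
            ; ⁻¹-cong = ≡.cong ⊝_ }
          ; comm = λ where (a , b) (c , d) → cong₂ _,_ (ℤ.+-comm a c) (ℤ.+-comm b d) }
        ; *-cong = cong₂ _⊗_
        ; *-assoc = ⊗-assoc
        ; *-identity = ⊗-identityˡ , λ x → ≡.trans (⊗-comm x (ι (+ 1))) (⊗-identityˡ x)
        ; distrib = ⊗-distribˡ , ⊗-distribʳ }
      ; *-comm = ⊗-comm } }

module QuadraticModPrime (p : ℕ) .{{_ : NonZero p}} (p-prime : Prime p) (t : ℤ) where
  open import Data.Integer using (+_; -_; _+_; _-_; _*_)

  open IntegersModPrime p p-prime hiding (^-congˡ; ^-congʳ; ^-homo-*; ^-distrib-*) renaming (_^_ to _^ℤ_)
  open Quadratic t public

  infix 4 _≈ₚ_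
  record _≈ₚ_ (x y : ℤ × ℤ) : Set where
    constructor _,_
    field ≈₁ : proj₁ x ≡ₚ proj₁ y
          ≈₂ : proj₂ x ≡ₚ proj₂ y
  open _≈ₚ_ public

  ≈ₚ-isEquivalence : IsEquivalence _≈ₚ_
  ≈ₚ-isEquivalence = record
    { refl = ≡ₚ-refl , ≡ₚ-refl
    ; sym = λ (a , b) → ≡ₚ-sym a , ≡ₚ-sym b
    ; trans = λ (a , b) (c , d) → ≡ₚ-trans a c , ≡ₚ-trans b d }

  ⊗≈ₚ : ∀ {a b c d e f} → a * c - b * d ≡ₚ e → a * d + b * c + t * (b * d) ≡ₚ f →
        (a , b) ⊗ (c , d) ≈ₚ (e , f)
  ⊗≈ₚ {a} {b} {c} {d} e≡ f≡ rewrite ⊗-def a b c d = e≡ , f≡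

  ℤₚ[ζ] : CommutativeRing 0ℓ 0ℓ
  ℤₚ[ζ] = quotientCommutativeRing ℤ[ζ] _≈ₚ_ ≈ₚ-isEquivalence (λ where ≡.refl → ≡ₚ-refl , ≡ₚ-refl)
    (λ (a , b) (c , d) → +-congₚ a c , +-congₚ b d) ⊗-congₚ (λ (a , b) → neg-congₚ a , neg-congₚ b)
    where
    open IsEquivalence ≈ₚ-isEquivalence using () renaming (sym to ≈ₚ-sym; trans to ≈ₚ-trans)
    ⊗-congₚ : ∀ {x x′ y y′} → x ≈ₚ x′ → y ≈ₚ y′ → x ⊗ y ≈ₚ x′ ⊗ y′
    ⊗-congₚ (a , b) (c , d) = ≈ₚ-trans
      (⊗≈ₚ (minus-congₚ (*-congₚ a c) (*-congₚ b d))
           (+-congₚ (+-congₚ (*-congₚ a d) (*-congₚ b c)) (*-congₚ (≡ₚ-refl {t}) (*-congₚ b d))))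
      (≈ₚ-sym (⊗≈ₚ ≡ₚ-refl ≡ₚ-refl))

  open CommutativeRing ℤₚ[ζ] public
    using (_≈_; setoid; 1#; +-rawMonoid; semiring; commutativeSemiring; *-comm; *-assoc; *-identityʳ; *-identityˡ)
    renaming (refl to ≈-refl; sym to ≈-sym; trans to ≈-trans; reflexive to ≡⇒≈; +-cong to ⊕-cong; *-cong to ⊗-cong)
  open import Algebra.Properties.Semiring.Exp semiring public using (_^_; ^-congˡ; ^-congʳ; ^-homo-*; ^-assocʳ)
  open import Algebra.Properties.CommutativeSemiring.Exp commutativeSemiring using (^-distrib-*)
  open import Algebra.Definitions.RawMonoid +-rawMonoid using () renaming (_×_ to _×ζ_)
  open import Algebra.Definitions.RawMonoid (CommutativeRing.+-rawMonoid ℤₚ) using () renaming (_×_ to _×ℤ_)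
  open import Relation.Binary.Reasoning.Setoid setoid

  ×ζ-componentwise : ∀ n a b → n ×ζ (a , b) ≡ (n ×ℤ a , n ×ℤ b)
  ×ζ-componentwise zero    a b = ≡.refl
  ×ζ-componentwise (suc n) a b = ≡.cong ((a , b) ⊕_) (×ζ-componentwise n a b)

  frobeniusζ : ∀ x y → (x ⊕ y) ^ p ≈ x ^ p ⊕ y ^ p
  frobeniusζ = frobenius ℤₚ[ζ] p-prime λ (a , b) →
    ≈-trans (≡⇒≈ (×ζ-componentwise p a b)) (characteristic a , characteristic b)

  ι-cong : ∀ {a b} → a ≡ₚ b → ι a ≈ ι b
  ι-cong a≡b = a≡b , ≡ₚ-refl

  ι-* : ∀ a b → ι a ⊗ ι b ≈ ι (a * b)
  ι-* a b = ⊗≈ₚ (≡⇒≡ₚ (lemma₁ a b)) (≡⇒≡ₚ (lemma₂ a b t))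
    where lemma₁ : ∀ a b → a * b - + 0 * + 0 ≡ a * b
          lemma₁ = solve-∀
          lemma₂ : ∀ a b t → a * + 0 + + 0 * b + t * (+ 0 * + 0) ≡ + 0
          lemma₂ = solve-∀

  ι-^ : ∀ a n → ι a ^ n ≈ ι (a ^ℤ n)
  ι-^ a zero    = ≈-refl
  ι-^ a (suc n) = ≈-trans (⊗-cong (≈-refl {ι a}) (ι-^ a n)) (ι-* a (a ^ℤ n))

  ι-fermat : ∀ a → ι a ^ p ≈ ι a
  ι-fermat a = ≈-trans (ι-^ a p) (ι-cong (fermat a))

  ζ⊗ζ̄≈1 : ζ ⊗ ζ̄ ≈ 1#
  ζ⊗ζ̄≈1 = ⊗≈ₚ (≡⇒≡ₚ (lemma₁ t)) (≡⇒≡ₚ (lemma₂ t))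
    where lemma₁ : ∀ t → + 0 * t - + 1 * (- + 1) ≡ + 1
          lemma₁ = solve-∀
          lemma₂ : ∀ t → + 0 * (- + 1) + + 1 * t + t * (+ 1 * (- + 1)) ≡ + 0
          lemma₂ = solve-∀

  ζ-cancelˡ : ∀ {x y} → ζ ⊗ x ≈ ζ ⊗ y → x ≈ y
  ζ-cancelˡ {x} {y} ζx≈ζy = begin
    x             ≈⟨ unit x ⟨
    ζ̄ ⊗ (ζ ⊗ x)   ≈⟨ ⊗-cong (≈-refl {ζ̄}) ζx≈ζy ⟩
    ζ̄ ⊗ (ζ ⊗ y)   ≈⟨ unit y ⟩
    y             ∎
    where
    unit : ∀ z → ζ̄ ⊗ (ζ ⊗ z) ≈ z
    unit z = ≈-trans (≈-sym (*-assoc ζ̄ ζ z))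
               (≈-trans (⊗-cong (≈-trans (*-comm ζ̄ ζ) ζ⊗ζ̄≈1) (≈-refl {z})) (*-identityˡ z))

  ι2-cancelˡ : ¬ p∣ + 2 → ∀ {x y} → ι (+ 2) ⊗ x ≈ ι (+ 2) ⊗ y → x ≈ y
  ι2-cancelˡ p∤2 {a , b} {c , d} 2x≈2y =
    p∤-cancelˡ p∤2 (≡ₚ-trans (≡⇒≡ₚ (≡.sym (lemma₁ a b))) (≡ₚ-trans (≈₁ 2a,2b≈2c,2d) (≡⇒≡ₚ (lemma₁ c d)))) ,
    p∤-cancelˡ p∤2 (≡ₚ-trans (≡⇒≡ₚ (≡.sym (lemma₂ a b t))) (≡ₚ-trans (≈₂ 2a,2b≈2c,2d) (≡⇒≡ₚ (lemma₂ c d t))))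
    where
    lemma₁ : ∀ a b → + 2 * a - + 0 * b ≡ + 2 * a
    lemma₁ = solve-∀
    lemma₂ : ∀ a b t → + 2 * b + + 0 * a + t * (+ 0 * b) ≡ + 2 * b
    lemma₂ = solve-∀
    2a,2b≈2c,2d : (+ 2 * a - + 0 * b , + 2 * b + + 0 * a + t * (+ 0 * b))
                ≈ (+ 2 * c - + 0 * d , + 2 * d + + 0 * c + t * (+ 0 * d))
    2a,2b≈2c,2d = ≈-trans (≈-sym (⊗≈ₚ ≡ₚ-refl ≡ₚ-refl)) (≈-trans 2x≈2y (⊗≈ₚ ≡ₚ-refl ≡ₚ-refl))

  -1≉1 : ¬ p∣ + 2 → ¬ ι (- + 1) ≈ 1#
  -1≉1 p∤2 = -1≢ₚ1 p∤2 ∘ ≈₁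

  -- δ = 2ζ − t squares to t² − 4, so Euler's criterion gives δ^p = ±δ: the Frobenius fixes or
  -- conjugates ζ.
  module _ {k} (p≡2k+1 : p ≡ suc (k ℕ.+ k)) (p∤2 : ¬ p∣ + 2) (p∤t²-4 : ¬ p∣ t * t - + 4) where

    δ : ℤ × ℤ
    δ = (- t , + 2)

    δ⊗δ≈ι[t²-4] : δ ⊗ δ ≈ ι (t * t - + 4)
    δ⊗δ≈ι[t²-4] = ⊗≈ₚ (≡⇒≡ₚ (lemma₁ t)) (≡⇒≡ₚ (lemma₂ t))
      where lemma₁ : ∀ t → (- t) * (- t) - + 2 * + 2 ≡ t * t - + 4
            lemma₁ = solve-∀
            lemma₂ : ∀ t → (- t) * + 2 + + 2 * (- t) + t * (+ 2 * + 2) ≡ + 0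
            lemma₂ = solve-∀

    2ζ≈t+δ : ι (+ 2) ⊗ ζ ≈ ι t ⊕ δ
    2ζ≈t+δ = ⊗≈ₚ (≡⇒≡ₚ (lemma₁ t)) (≡⇒≡ₚ (lemma₂ t))
      where lemma₁ : ∀ t → + 2 * + 0 - + 0 * + 1 ≡ t + - t
            lemma₁ = solve-∀
            lemma₂ : ∀ t → + 2 * + 1 + + 0 * + 0 + t * (+ 0 * + 1) ≡ + 0 + + 2
            lemma₂ = solve-∀

    2ζ̄≈t-δ : ι (+ 2) ⊗ ζ̄ ≈ ι t ⊕ δ ⊗ ι (- + 1)
    2ζ̄≈t-δ = ≈-trans (⊗≈ₚ (≡⇒≡ₚ (lemma₁ t)) (≡⇒≡ₚ (lemma₂ t)))
                     (⊕-cong (≈-refl {ι t}) (≈-sym (⊗≈ₚ ≡ₚ-refl ≡ₚ-refl)))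
      where
      lemma₁ : ∀ t → + 2 * t - + 0 * - + 1 ≡ t + ((- t) * (- + 1) - + 2 * + 0)
      lemma₁ = solve-∀
      lemma₂ : ∀ t → + 2 * - + 1 + + 0 * t + t * (+ 0 * - + 1) ≡
                     + 0 + ((- t) * + 0 + + 2 * (- + 1) + t * (+ 2 * + 0))
      lemma₂ = solve-∀

    δ^p≈δ⊗ι[D^k] : δ ^ p ≈ δ ⊗ ι ((t * t - + 4) ^ℤ k)
    δ^p≈δ⊗ι[D^k] = begin
      δ ^ p                          ≈⟨ ^-congʳ δ p≡2k+1 ⟩
      δ ⊗ δ ^ (k ℕ.+ k)              ≈⟨ ⊗-cong (≈-refl {δ}) (^-homo-* δ k k) ⟩
      δ ⊗ (δ ^ k ⊗ δ ^ k)            ≈⟨ ⊗-cong (≈-refl {δ}) (^-distrib-* δ δ k) ⟨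
      δ ⊗ (δ ⊗ δ) ^ k                ≈⟨ ⊗-cong (≈-refl {δ}) (^-congˡ k δ⊗δ≈ι[t²-4]) ⟩
      δ ⊗ ι (t * t - + 4) ^ k        ≈⟨ ⊗-cong (≈-refl {δ}) (ι-^ (t * t - + 4) k) ⟩
      δ ⊗ ι ((t * t - + 4) ^ℤ k)     ∎

    2ζ^p≈t+δ⊗ι[D^k] : ι (+ 2) ⊗ ζ ^ p ≈ ι t ⊕ δ ⊗ ι ((t * t - + 4) ^ℤ k)
    2ζ^p≈t+δ⊗ι[D^k] = begin
      ι (+ 2) ⊗ ζ ^ p              ≈⟨ ⊗-cong (ι-fermat (+ 2)) (≈-refl {ζ ^ p}) ⟨
      ι (+ 2) ^ p ⊗ ζ ^ p          ≈⟨ ^-distrib-* (ι (+ 2)) ζ p ⟨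
      (ι (+ 2) ⊗ ζ) ^ p            ≈⟨ ^-congˡ p 2ζ≈t+δ ⟩
      (ι t ⊕ δ) ^ p                ≈⟨ frobeniusζ (ι t) δ ⟩
      ι t ^ p ⊕ δ ^ p              ≈⟨ ⊕-cong (ι-fermat t) δ^p≈δ⊗ι[D^k] ⟩
      ι t ⊕ δ ⊗ ι ((t * t - + 4) ^ℤ k) ∎

    ζ^p≈ζ⊎ζ̄ : ζ ^ p ≈ ζ ⊎ ζ ^ p ≈ ζ̄
    ζ^p≈ζ⊎ζ̄ = Sum.map fixed conjugated (euler {k} p≡2k+1 {t * t - + 4} p∤t²-4)
      where
      D^k : ℤ
      D^k = (t * t - + 4) ^ℤ k
      fixed : D^k ≡ₚ + 1 → ζ ^ p ≈ ζ
      fixed D^k≡1 = ι2-cancelˡ p∤2 (begin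
        ι (+ 2) ⊗ ζ ^ p     ≈⟨ 2ζ^p≈t+δ⊗ι[D^k] ⟩
        ι t ⊕ δ ⊗ ι D^k     ≈⟨ ⊕-cong (≈-refl {ι t}) (⊗-cong (≈-refl {δ}) (ι-cong D^k≡1)) ⟩
        ι t ⊕ δ ⊗ 1#        ≈⟨ ⊕-cong (≈-refl {ι t}) (*-identityʳ δ) ⟩
        ι t ⊕ δ             ≈⟨ 2ζ≈t+δ ⟨
        ι (+ 2) ⊗ ζ         ∎)
      conjugated : D^k ≡ₚ - + 1 → ζ ^ p ≈ ζ̄
      conjugated D^k≡-1 = ι2-cancelˡ p∤2 (begin
        ι (+ 2) ⊗ ζ ^ p     ≈⟨ 2ζ^p≈t+δ⊗ι[D^k] ⟩
        ι t ⊕ δ ⊗ ι D^k     ≈⟨ ⊕-cong (≈-refl {ι t}) (⊗-cong (≈-refl {δ}) (ι-cong D^k≡-1)) ⟩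
        ι t ⊕ δ ⊗ ι (- + 1) ≈⟨ 2ζ̄≈t-δ ⟨
        ι (+ 2) ⊗ ζ̄         ∎)

    ζ^[p-1]≈1⊎ζ^[p+1]≈1 : ζ ^ (k ℕ.+ k) ≈ 1# ⊎ ζ ^ suc (suc (k ℕ.+ k)) ≈ 1#
    ζ^[p-1]≈1⊎ζ^[p+1]≈1 = Sum.map fixed conjugated ζ^p≈ζ⊎ζ̄
      where
      fixed : ζ ^ p ≈ ζ → ζ ^ (k ℕ.+ k) ≈ 1#
      fixed ζ^p≈ζ = ζ-cancelˡ (begin
        ζ ⊗ ζ ^ (k ℕ.+ k)  ≈⟨ ^-congʳ ζ p≡2k+1 ⟨
        ζ ^ p              ≈⟨ ζ^p≈ζ ⟩
        ζ                  ≈⟨ *-identityʳ ζ ⟨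
        ζ ⊗ 1#             ∎)
      conjugated : ζ ^ p ≈ ζ̄ → ζ ^ suc (suc (k ℕ.+ k)) ≈ 1#
      conjugated ζ^p≈ζ̄ = begin
        ζ ⊗ ζ ^ suc (k ℕ.+ k) ≈⟨ ⊗-cong (≈-refl {ζ}) (^-congʳ ζ p≡2k+1) ⟨
        ζ ⊗ ζ ^ p             ≈⟨ ⊗-cong (≈-refl {ζ}) ζ^p≈ζ̄ ⟩
        ζ ⊗ ζ̄                 ≈⟨ ζ⊗ζ̄≈1 ⟩
        1#                    ∎

    ζ^r≈1⊎ζ^[r+2]≈1 : ∀ a q r → ζ ^ a ≈ 1# → k ℕ.+ k ≡ q ℕ.* a ℕ.+ r →
                      ζ ^ r ≈ 1# ⊎ ζ ^ (r ℕ.+ 2) ≈ 1#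
    ζ^r≈1⊎ζ^[r+2]≈1 a q r ζ^a≈1 k+k≡qa+r = Sum.map reduce reduce′ ζ^[p-1]≈1⊎ζ^[p+1]≈1
      where
      reduce : ζ ^ (k ℕ.+ k) ≈ 1# → ζ ^ r ≈ 1#
      reduce ζ^[k+k]≈1 = begin
        ζ ^ r                  ≈⟨ ^-periodic ℤₚ[ζ] a q r ζ^a≈1 ⟨
        ζ ^ (q ℕ.* a ℕ.+ r)    ≡⟨ ≡.cong (ζ ^_) k+k≡qa+r ⟨
        ζ ^ (k ℕ.+ k)          ≈⟨ ζ^[k+k]≈1 ⟩
        1#                     ∎
      reduce′ : ζ ^ suc (suc (k ℕ.+ k)) ≈ 1# → ζ ^ (r ℕ.+ 2) ≈ 1#
      reduce′ ζ^[k+k+2]≈1 = begin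
        ζ ^ (r ℕ.+ 2)               ≈⟨ ^-periodic ℤₚ[ζ] a q (r ℕ.+ 2) ζ^a≈1 ⟨
        ζ ^ (q ℕ.* a ℕ.+ (r ℕ.+ 2)) ≡⟨ ≡.cong (ζ ^_) (≡.trans (≡.sym (ℕ.+-assoc (q ℕ.* a) r 2)) (ℕ.+-comm _ 2)) ⟩
        ζ ^ (2 ℕ.+ (q ℕ.* a ℕ.+ r)) ≡⟨ ≡.cong (λ m → ζ ^ (2 ℕ.+ m)) k+k≡qa+r ⟨
        ζ ^ suc (suc (k ℕ.+ k))     ≈⟨ ζ^[k+k+2]≈1 ⟩
        1#                          ∎

  ζ²≈ : ζ ^ 2 ≈ (- + 1 , t)
  ζ²≈ = ≈-trans (⊗-cong (≈-refl {ζ}) (*-identityʳ ζ)) (⊗≈ₚ (≡⇒≡ₚ (lemma₁ t)) (≡⇒≡ₚ (lemma₂ t)))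
    where lemma₁ : ∀ t → + 0 * + 0 - + 1 * + 1 ≡ - + 1
          lemma₁ = solve-∀
          lemma₂ : ∀ t → + 0 * + 1 + + 1 * + 0 + t * (+ 1 * + 1) ≡ t
          lemma₂ = solve-∀

  ζ⁴≈ : ζ ^ 4 ≈ (+ 1 - t * t , t * t * t - + 2 * t)
  ζ⁴≈ = begin
    ζ ^ 4                 ≈⟨ ^-assocʳ ζ 2 2 ⟨
    (ζ ^ 2) ^ 2           ≈⟨ ^-congˡ 2 ζ²≈ ⟩
    (- + 1 , t) ^ 2       ≈⟨ ⊗-cong (≈-refl {(- + 1 , t)}) (*-identityʳ (- + 1 , t)) ⟩
    (- + 1 , t) ⊗ (- + 1 , t) ≈⟨ ⊗≈ₚ (≡⇒≡ₚ (lemma₁ t)) (≡⇒≡ₚ (lemma₂ t)) ⟩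
    (+ 1 - t * t , t * t * t - + 2 * t) ∎
    where lemma₁ : ∀ t → - + 1 * - + 1 - t * t ≡ + 1 - t * t
          lemma₁ = solve-∀
          lemma₂ : ∀ t → - + 1 * t + t * - + 1 + t * (t * t) ≡ t * t * t - + 2 * t
          lemma₂ = solve-∀

  -- For t² = 2 (resp. 3) the element ζ is a primitive 8th (resp. 12th) root of unity; against
  -- ζ^(p ∓ 1) = 1 this makes 2 and 3 nonresidues for p ≡ 3 (mod 8) and p ≡ 7 (mod 12).
  module _ (p∣t²-2 : p∣ t * t - + 2) where

    ζ⁴≈-1 : ζ ^ 4 ≈ ι (- + 1)
    ζ⁴≈-1 = ≈-trans ζ⁴≈
      (mk≡ₚ (∣-respʳ (lemma₁ t) (∣m⇒∣-m p∣t²-2)) , mk≡ₚ (∣-respʳ (lemma₂ t) (∣n⇒∣m*n t p∣t²-2)))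
      where lemma₁ : ∀ t → - (t * t - + 2) ≡ (+ 1 - t * t) - - + 1
            lemma₁ = solve-∀
            lemma₂ : ∀ t → t * (t * t - + 2) ≡ (t * t * t - + 2 * t) - + 0
            lemma₂ = solve-∀

    ζ⁸≈1 : ζ ^ 8 ≈ 1#
    ζ⁸≈1 = begin
      ζ ^ 8                  ≈⟨ ^-homo-* ζ 4 4 ⟩
      ζ ^ 4 ⊗ ζ ^ 4          ≈⟨ ⊗-cong ζ⁴≈-1 ζ⁴≈-1 ⟩
      ι (- + 1) ⊗ ι (- + 1)  ≈⟨ ι-* (- + 1) (- + 1) ⟩
      1#                     ∎

  module _ (p∣t²-3 : p∣ t * t - + 3) where

    ζ⁶≈-1 : ζ ^ 6 ≈ ι (- + 1)
    ζ⁶≈-1 = begin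
      ζ ^ 6                      ≈⟨ ^-homo-* ζ 4 2 ⟩
      ζ ^ 4 ⊗ ζ ^ 2              ≈⟨ ⊗-cong (≈-trans ζ⁴≈ ζ⁴≈-2+t) ζ²≈ ⟩
      (- + 2 , t) ⊗ (- + 1 , t)  ≈⟨ ⊗≈ₚ (mk≡ₚ (∣-respʳ (lemma₃ t) (∣m⇒∣-m p∣t²-3)))
                                         (mk≡ₚ (∣-respʳ (lemma₄ t) (∣n⇒∣m*n t p∣t²-3))) ⟩
      ι (- + 1)                  ∎
      where
      lemma₁ : ∀ t → - (t * t - + 3) ≡ (+ 1 - t * t) - - + 2
      lemma₁ = solve-∀
      lemma₂ : ∀ t → t * (t * t - + 3) ≡ (t * t * t - + 2 * t) - t
      lemma₂ = solve-∀
      lemma₃ : ∀ t → - (t * t - + 3) ≡ (- + 2 * - + 1 - t * t) - - + 1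
      lemma₃ = solve-∀
      lemma₄ : ∀ t → t * (t * t - + 3) ≡ (- + 2 * t + t * - + 1 + t * (t * t)) - + 0
      lemma₄ = solve-∀
      ζ⁴≈-2+t : (+ 1 - t * t , t * t * t - + 2 * t) ≈ (- + 2 , t)
      ζ⁴≈-2+t = mk≡ₚ (∣-respʳ (lemma₁ t) (∣m⇒∣-m p∣t²-3)) , mk≡ₚ (∣-respʳ (lemma₂ t) (∣n⇒∣m*n t p∣t²-3))

    ζ¹²≈1 : ζ ^ 12 ≈ 1#
    ζ¹²≈1 = begin
      ζ ^ 12                 ≈⟨ ^-homo-* ζ 6 6 ⟩
      ζ ^ 6 ⊗ ζ ^ 6          ≈⟨ ⊗-cong ζ⁶≈-1 ζ⁶≈-1 ⟩
      ι (- + 1) ⊗ ι (- + 1)  ≈⟨ ι-* (- + 1) (- + 1) ⟩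
      1#                     ∎

    ζ⁸≈ : ζ ^ 8 ≈ (+ 1 , - t)
    ζ⁸≈ = begin
      ζ ^ 8                    ≈⟨ ^-homo-* ζ 6 2 ⟩
      ζ ^ 6 ⊗ ζ ^ 2            ≈⟨ ⊗-cong ζ⁶≈-1 ζ²≈ ⟩
      ι (- + 1) ⊗ (- + 1 , t)  ≈⟨ ⊗≈ₚ (≡⇒≡ₚ (lemma₁ t)) (≡⇒≡ₚ (lemma₂ t)) ⟩
      (+ 1 , - t)              ∎
      where lemma₁ : ∀ t → - + 1 * - + 1 - + 0 * t ≡ + 1
            lemma₁ = solve-∀
            lemma₂ : ∀ t → - + 1 * t + + 0 * - + 1 + t * (+ 0 * t) ≡ - t
            lemma₂ = solve-∀

  norm trace : ℤ × ℤ → ℤ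
  norm  (a , b) = a * a + a * b * t + b * b
  trace (a , b) = + 2 * a + b * t

  norm-cong : ∀ {x y} → x ≈ y → norm x ≡ₚ norm y
  norm-cong (a , b) = +-congₚ (+-congₚ (*-congₚ a a) (*-congₚ (*-congₚ a b) (≡ₚ-refl {t}))) (*-congₚ b b)

  trace-cong : ∀ {x y} → x ≈ y → trace x ≡ₚ trace y
  trace-cong (a , b) = +-congₚ (*-congₚ (≡ₚ-refl {+ 2}) a) (*-congₚ b (≡ₚ-refl {t}))

  norm-⊗ : ∀ x y → norm (x ⊗ y) ≡ₚ norm x * norm y
  norm-⊗ (a , b) (c , d) = ≡ₚ-trans (norm-cong (⊗≈ₚ ≡ₚ-refl ≡ₚ-refl)) (≡⇒≡ₚ (lemma a b c d t))
    where
    lemma : ∀ a b c d t →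
      (a * c - b * d) * (a * c - b * d) + (a * c - b * d) * (a * d + b * c + t * (b * d)) * t
        + (a * d + b * c + t * (b * d)) * (a * d + b * c + t * (b * d)) ≡
      (a * a + a * b * t + b * b) * (c * c + c * d * t + d * d)
    lemma = solve-∀

  norm-ζ^ : ∀ n → norm (ζ ^ n) ≡ₚ + 1
  norm-ζ^ zero    = ≡⇒≡ₚ (lemma t)
    where lemma : ∀ t → + 1 * + 1 + + 1 * + 0 * t + + 0 * + 0 ≡ + 1
          lemma = solve-∀
  norm-ζ^ (suc n) = ≡ₚ-trans (norm-⊗ ζ (ζ ^ n)) (*-congₚ (≡⇒≡ₚ (lemma t)) (norm-ζ^ n))
    where lemma : ∀ t → + 0 * + 0 + + 0 * + 1 * t + + 1 * + 1 ≡ + 1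
          lemma = solve-∀

  trace-square : ∀ x → trace (x ⊗ x) ≡ₚ trace x * trace x - + 2 * norm x
  trace-square (a , b) = ≡ₚ-trans (trace-cong (⊗≈ₚ ≡ₚ-refl ≡ₚ-refl)) (≡⇒≡ₚ (lemma a b t))
    where
    lemma : ∀ a b t → + 2 * (a * a - b * b) + (a * b + b * a + t * (b * b)) * t ≡
                      (+ 2 * a + b * t) * (+ 2 * a + b * t) - + 2 * (a * a + a * b * t + b * b)
    lemma = solve-∀

  trace-ζ^[n+n] : ∀ n {u} → trace (ζ ^ n) ≡ₚ u → trace (ζ ^ (n ℕ.+ n)) ≡ₚ u * u - + 2
  trace-ζ^[n+n] n {u} tr≡u = ≡ₚ-trans (trace-cong (^-homo-* ζ n n)) (≡ₚ-trans (trace-square (ζ ^ n))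
    (≡ₚ-trans (minus-congₚ (*-congₚ tr≡u tr≡u) (*-congₚ (≡ₚ-refl {+ 2}) (norm-ζ^ n))) (≡⇒≡ₚ (lemma u))))
    where lemma : ∀ u → u * u - + 2 * + 1 ≡ u * u - + 2
          lemma = solve-∀

  trace-ζ³ : trace (ζ ^ 3) ≡ₚ t * t * t - + 3 * t
  trace-ζ³ = ≡ₚ-trans (trace-cong (≈-trans (⊗-cong (≈-refl {ζ}) ζ²≈) (⊗≈ₚ ≡ₚ-refl ≡ₚ-refl))) (≡⇒≡ₚ (lemma t))
    where lemma : ∀ t → + 2 * (+ 0 * - + 1 - + 1 * t) + (+ 0 * t + + 1 * - + 1 + t * (+ 1 * t)) * t ≡
                        t * t * t - + 3 * t
          lemma = solve-∀

module MinusOneNonresidue (p : ℕ) .{{_ : NonZero p}} (p-prime : Prime p) {m} (p≡4m+3 : p ≡ 4 ℕ.* m ℕ.+ 3) where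
  open import Data.Integer using (+_; -_; _+_; _-_; _*_)

  open IntegersModPrime p p-prime

  private
    k : ℕ
    k = m ℕ.* 2 ℕ.+ 1

    p≡2k+1 : p ≡ suc (k ℕ.+ k)
    p≡2k+1 = ≡.trans p≡4m+3 (lemma m)
      where lemma : ∀ m → 4 ℕ.* m ℕ.+ 3 ≡ suc ((m ℕ.* 2 ℕ.+ 1) ℕ.+ (m ℕ.* 2 ℕ.+ 1))
            lemma = ℕ-Solver.solve-∀

    3≤p : 3 ℕ.≤ p
    3≤p = ≡.subst (3 ℕ.≤_) (≡.sym p≡4m+3) (ℕ.m≤n+m 3 _)

  -1-nonresidue : ∀ s → ¬ p∣ s * s + + 1
  -1-nonresidue s p∣s²+1 = -1≢ₚ1 p∤2 (begin
    - + 1           ≈⟨ ^-periodic ℤₚ 2 m 1 ≡ₚ-refl ⟨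
    (- + 1) ^ k     ≈⟨ ^-congˡ k s²≡-1 ⟨
    (s * s) ^ k     ≈⟨ ^-distrib-* s s k ⟩
    s ^ k * s ^ k   ≈⟨ ^-homo-* s k k ⟨
    s ^ (k ℕ.+ k)   ≈⟨ fermat-unit {k} p≡2k+1 p∤s ⟩
    + 1             ∎)
    where
    open import Relation.Binary.Reasoning.Setoid (CommutativeRing.setoid ℤₚ)
    p∤2 : ¬ p∣ + 2
    p∤2 = p∤-below 3≤p (s≤s z≤n) ℕ.≤-refl
    lemma₁ : ∀ s → s * s + + 1 + - (s * s) ≡ + 1
    lemma₁ = solve-∀
    p∤s : ¬ p∣ s
    p∤s p∣s = p∤-below 3≤p (s≤s z≤n) (s≤s (s≤s z≤n))
      (∣-respʳ (lemma₁ s) (∣m∣n⇒∣m+n p∣s²+1 (∣m⇒∣-m (∣n⇒∣m*n s p∣s))))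
    lemma₂ : ∀ s → s * s + + 1 ≡ s * s - - + 1
    lemma₂ = solve-∀
    s²≡-1 : s * s ≡ₚ - + 1
    s²≡-1 = mk≡ₚ (∣-respʳ (lemma₂ s) p∣s²+1)

  sum-of-squares : ∀ a b → p∣ a * a + b * b → p∣ b
  sum-of-squares a b p∣a²+b² = decidable-stable (+ p ℤ.∣? b) p∤b⇒⊥
    where
    lemma : ∀ a b u → u * u * (a * a + b * b) + (+ 1 + b * u) * (+ 1 - b * u) ≡ a * u * (a * u) + + 1
    lemma = solve-∀
    p∤b⇒⊥ : ¬ ¬ p∣ b
    p∤b⇒⊥ p∤b with p∤⇒invertible p∤b
    ... | u , bu≡1 = -1-nonresidue (a * u) (∣-respʳ (lemma a b u)
      (∣m∣n⇒∣m+n (∣n⇒∣m*n (u * u) p∣a²+b²) (∣n⇒∣m*n (+ 1 + b * u) (p∣difference (≡ₚ-sym bu≡1)))))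

module TwoNonresidue (p : ℕ) .{{_ : NonZero p}} (p-prime : Prime p) {m} (p≡8m+3 : p ≡ 8 ℕ.* m ℕ.+ 3) where
  open import Data.Integer using (+_; -_; _+_; _-_; _*_)

  open IntegersModPrime p p-prime using (p∣_; -1≢ₚ1; p∤-below)

  private
    k : ℕ
    k = m ℕ.* 4 ℕ.+ 1

    p≡2k+1 : p ≡ suc (k ℕ.+ k)
    p≡2k+1 = ≡.trans p≡8m+3 (lemma m)
      where lemma : ∀ m → 8 ℕ.* m ℕ.+ 3 ≡ suc ((m ℕ.* 4 ℕ.+ 1) ℕ.+ (m ℕ.* 4 ℕ.+ 1))
            lemma = ℕ-Solver.solve-∀

    k+k≡8m+2 : k ℕ.+ k ≡ m ℕ.* 8 ℕ.+ 2
    k+k≡8m+2 = lemma m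
      where lemma : ∀ m → (m ℕ.* 4 ℕ.+ 1) ℕ.+ (m ℕ.* 4 ℕ.+ 1) ≡ m ℕ.* 8 ℕ.+ 2
            lemma = ℕ-Solver.solve-∀

    p∤2 : ¬ p∣ + 2
    p∤2 = p∤-below (≡.subst (3 ℕ.≤_) (≡.sym p≡8m+3) (ℕ.m≤n+m 3 _)) (s≤s z≤n) ℕ.≤-refl

  2-nonresidue : ∀ s → ¬ p∣ s * s - + 2
  2-nonresidue s p∣s²-2 =
    [ ζ²≉1 , -1≉1 p∤2 ∘ ≈-trans (≈-sym (ζ⁴≈-1 p∣s²-2)) ]′
      (ζ^r≈1⊎ζ^[r+2]≈1 {k} p≡2k+1 p∤2 p∤s²-4 8 m 2 (ζ⁸≈1 p∣s²-2) k+k≡8m+2)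
    where
    open QuadraticModPrime p p-prime s
    lemma : ∀ s → - (s * s - + 4) + (s * s - + 2) ≡ + 2
    lemma = solve-∀
    p∤s²-4 : ¬ p∣ s * s - + 4
    p∤s²-4 p∣s²-4 = p∤2 (∣-respʳ (lemma s) (∣m∣n⇒∣m+n (∣m⇒∣-m p∣s²-4) p∣s²-2))
    ζ²≉1 : ¬ ζ ^ 2 ≈ 1#
    ζ²≉1 ζ²≈1 = -1≢ₚ1 p∤2 (≈₁ (≈-trans (≈-sym ζ²≈) ζ²≈1))

module ThreeNonresidue (p : ℕ) .{{_ : NonZero p}} (p-prime : Prime p) {m} (p≡12m+7 : p ≡ 12 ℕ.* m ℕ.+ 7) where
  open import Data.Integer using (+_; -_; _+_; _-_; _*_)

  open IntegersModPrime p p-prime using (p∣_; p∣difference; p∤-below)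

  private
    k : ℕ
    k = m ℕ.* 6 ℕ.+ 3

    p≡2k+1 : p ≡ suc (k ℕ.+ k)
    p≡2k+1 = ≡.trans p≡12m+7 (lemma m)
      where lemma : ∀ m → 12 ℕ.* m ℕ.+ 7 ≡ suc ((m ℕ.* 6 ℕ.+ 3) ℕ.+ (m ℕ.* 6 ℕ.+ 3))
            lemma = ℕ-Solver.solve-∀

    k+k≡12m+6 : k ℕ.+ k ≡ m ℕ.* 12 ℕ.+ 6
    k+k≡12m+6 = lemma m
      where lemma : ∀ m → (m ℕ.* 6 ℕ.+ 3) ℕ.+ (m ℕ.* 6 ℕ.+ 3) ≡ m ℕ.* 12 ℕ.+ 6
            lemma = ℕ-Solver.solve-∀

    7≤p : 7 ℕ.≤ p
    7≤p = ≡.subst (7 ℕ.≤_) (≡.sym p≡12m+7) (ℕ.m≤n+m 7 _)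

    p∤2 : ¬ p∣ + 2
    p∤2 = p∤-below 7≤p (s≤s z≤n) (s≤s (s≤s (s≤s z≤n)))

  3-nonresidue : ∀ s → ¬ p∣ s * s - + 3
  3-nonresidue s p∣s²-3 =
    [ -1≉1 p∤2 ∘ ≈-trans (≈-sym (ζ⁶≈-1 p∣s²-3)) , ζ⁸≉1 ]′
      (ζ^r≈1⊎ζ^[r+2]≈1 {k} p≡2k+1 p∤2 p∤s²-4 12 m 6 (ζ¹²≈1 p∣s²-3) k+k≡12m+6)
    where
    open QuadraticModPrime p p-prime s
    lemma₁ : ∀ s → - (s * s - + 4) + (s * s - + 3) ≡ + 1
    lemma₁ = solve-∀
    p∤s²-4 : ¬ p∣ s * s - + 4
    p∤s²-4 p∣s²-4 = p∤-below 7≤p (s≤s z≤n) (s≤s (s≤s z≤n))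
                      (∣-respʳ (lemma₁ s) (∣m∣n⇒∣m+n (∣m⇒∣-m p∣s²-4) p∣s²-3))
    lemma₂ : ∀ s → - (- s - + 0) ≡ s
    lemma₂ = solve-∀
    lemma₃ : ∀ s → s * s + - (s * s - + 3) ≡ + 3
    lemma₃ = solve-∀
    ζ⁸≉1 : ¬ ζ ^ 8 ≈ 1#
    ζ⁸≉1 ζ⁸≈1 = p∤-below 7≤p (s≤s z≤n) (s≤s (s≤s (s≤s (s≤s z≤n))))
                 (∣-respʳ (lemma₃ s) (∣m∣n⇒∣m+n (∣n⇒∣m*n s p∣s) (∣m⇒∣-m p∣s²-3)))
      where
      p∣s : p∣ s
      p∣s = ∣-respʳ (lemma₂ s) (∣m⇒∣-m (p∣difference (≈₂ (≈-trans (≈-sym (ζ⁸≈ p∣s²-3)) ζ⁸≈1))))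

module Iteration (p : ℕ) .{{_ : NonZero p}} where

  fIter-+ : ∀ m n P → fIter p (m ℕ.+ n) P ≡ fIter p m (fIter p n P)
  fIter-+ zero    n P = ≡.refl
  fIter-+ (suc m) n P = ≡.cong (f p) (fIter-+ m n P)

  fIter-* : ∀ {n P} q → fIter p n P ≡ P → fIter p (q ℕ.* n) P ≡ P
  fIter-* {n} {P} zero    _     = ≡.refl
  fIter-* {n} {P} (suc q) fixed = begin
    fIter p (n ℕ.+ q ℕ.* n) P      ≡⟨ fIter-+ n (q ℕ.* n) P ⟩
    fIter p n (fIter p (q ℕ.* n) P) ≡⟨ ≡.cong (fIter p n) (fIter-* q fixed) ⟩
    fIter p n P                    ≡⟨ fixed ⟩
    P                              ∎
    where open ≡.≡-Reasoning

  fIter-∣ : ∀ {n N P} → n ∣ N → fIter p n P ≡ P → fIter p N P ≡ P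
  fIter-∣ {n} {P = P} (divides q ≡.refl) fixed = fIter-* q fixed

  exactPeriod∣ : ∀ {n N P} → ExactPeriod p n P → fIter p N P ≡ P → n ∣ N
  exactPeriod∣ {suc n} {N} {P} (_ , fixed , minimal) N-fixed with N % suc n in r≡
  ... | zero  = divides (N / suc n) (≡.trans (m≡m%n+[m/n]*n N (suc n)) (≡.cong (ℕ._+ (N / suc n) ℕ.* suc n) r≡))
  ... | suc r = contradiction r-fixed (minimal (suc r) (s≤s z≤n) (≡.subst (_< suc n) r≡ (m%n<n N (suc n))))
    where
    open ≡.≡-Reasoning
    r-fixed : fIter p (suc r) P ≡ P
    r-fixed = begin
      fIter p (suc r) P                                  ≡⟨ ≡.cong (fIter p (suc r)) (fIter-* (N / suc n) fixed) ⟨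
      fIter p (suc r) (fIter p (N / suc n ℕ.* suc n) P)  ≡⟨ fIter-+ (suc r) _ P ⟨
      fIter p (suc r ℕ.+ N / suc n ℕ.* suc n) P          ≡⟨ ≡.cong (λ m → fIter p (m ℕ.+ N / suc n ℕ.* suc n) P) r≡ ⟨
      fIter p (N % suc n ℕ.+ N / suc n ℕ.* suc n) P      ≡⟨ ≡.cong (λ m → fIter p m P) (m≡m%n+[m/n]*n N (suc n)) ⟨
      fIter p N P                                        ≡⟨ N-fixed ⟩
      P                                                  ∎

module MarkoffOrbit (p : ℕ) .{{_ : NonZero p}} (p-prime : Prime p) (x y z : ℕ) where
  open import Data.Integer using (+_; -_; _+_; _-_; _*_)

  open IntegersModPrime p p-prime hiding (_^_; ^-congˡ; ^-congʳ; ^-homo-*; ^-distrib-*)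

  X Y Z t : ℤ
  X = + x
  Y = + y
  Z = + z
  t = Z * Z - + 2

  open QuadraticModPrime p p-prime t public

  v : ℤ × ℤ
  v = (X , Y)

  -- The matrix of f on (x , y) for fixed z; its characteristic polynomial is X² − tX + 1.
  T : ℤ × ℤ → ℤ × ℤ
  T (a , b) = ((Z * Z - + 1) * a - Z * b , Z * a - b)

  act : ℤ × ℤ → ℤ × ℤ → ℤ × ℤ
  act (α , β) w = (α * proj₁ w + β * proj₁ (T w) , α * proj₂ w + β * proj₂ (T w))

  T-cong : ∀ {w w′} → w ≈ w′ → T w ≈ T w′
  T-cong (a , b) =
    minus-congₚ (*-congₚ (≡ₚ-refl {Z * Z - + 1}) a) (*-congₚ (≡ₚ-refl {Z}) b) , minus-congₚ (*-congₚ (≡ₚ-refl {Z}) a) b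

  act-cong : ∀ {B B′ w w′} → B ≈ B′ → w ≈ w′ → act B w ≈ act B′ w′
  act-cong (α , β) w≈w′ =
    +-congₚ (*-congₚ α (≈₁ w≈w′)) (*-congₚ β (≈₁ (T-cong w≈w′))) ,
    +-congₚ (*-congₚ α (≈₂ w≈w′)) (*-congₚ β (≈₂ (T-cong w≈w′)))

  act-1 : ∀ w → act 1# w ≈ w
  act-1 (a , b) = ≡⇒≈ (cong₂ _,_ (lemma₁ a b Z) (lemma₂ a b Z))
    where lemma₁ : ∀ a b Z → + 1 * a + + 0 * ((Z * Z - + 1) * a - Z * b) ≡ a
          lemma₁ = solve-∀
          lemma₂ : ∀ a b Z → + 1 * b + + 0 * (Z * a - b) ≡ b
          lemma₂ = solve-∀

  act-ζ⊗ : ∀ B w → act (ζ ⊗ B) w ≈ T (act B w)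
  act-ζ⊗ (α , β) (a , b) =
    ≈-trans (act-cong ζB≈ (≈-refl {(a , b)})) (≡⇒≈ (cong₂ _,_ (lemma₁ α β a b Z) (lemma₂ α β a b Z)))
    where
    ζB≈ : ζ ⊗ (α , β) ≈ (- β , α + t * β)
    ζB≈ = ⊗≈ₚ (≡⇒≡ₚ (lemma α β)) (≡⇒≡ₚ (lemma′ α β t))
      where lemma : ∀ α β → + 0 * α - + 1 * β ≡ - β
            lemma = solve-∀
            lemma′ : ∀ α β t → + 0 * β + + 1 * α + t * (+ 1 * β) ≡ α + t * β
            lemma′ = solve-∀
    lemma₁ : ∀ α β a b Z → (- β) * a + (α + (Z * Z - + 2) * β) * ((Z * Z - + 1) * a - Z * b) ≡
                           (Z * Z - + 1) * (α * a + β * ((Z * Z - + 1) * a - Z * b)) - Z * (α * b + β * (Z * a - b))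
    lemma₁ = solve-∀
    lemma₂ : ∀ α β a b Z → (- β) * b + (α + (Z * Z - + 2) * β) * (Z * a - b) ≡
                           Z * (α * a + β * ((Z * Z - + 1) * a - Z * b)) - (α * b + β * (Z * a - b))
    lemma₂ = solve-∀

  record Represents (Q : Point) (w : ℤ × ℤ) : Set where
    constructor represents
    field
      z-coordinate : proj₂ (proj₂ Q) ≡ z
      x-coordinate : + proj₁ Q ≡ₚ proj₁ w
      y-coordinate : + proj₁ (proj₂ Q) ≡ₚ proj₂ w

  represents-f : ∀ {Q w} → Represents Q w → Represents (f p Q) (T w)
  represents-f {q₁ , q₂ , _} {a , b} (represents ≡.refl q₁≡a q₂≡b) = represents ≡.refl x′≡ y′≡
    where
    open import Relation.Binary.Reasoning.Setoid (CommutativeRing.setoid ℤₚ)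
    y′ : ℕ
    y′ = proj₁ (proj₂ (f p (q₁ , q₂ , z)))
    y′≡ : + y′ ≡ₚ Z * a - b
    y′≡ = begin
      + y′                          ≈⟨ %-minus-≡ₚ ((q₁ ℕ.* z) % p) q₂ ⟩
      + ((q₁ ℕ.* z) % p) - + q₂     ≈⟨ minus-congₚ (%-*-≡ₚ q₁ z) q₂≡b ⟩
      + q₁ * Z - b                  ≈⟨ minus-congₚ (*-congₚ q₁≡a (≡ₚ-refl {Z})) (≡ₚ-refl {b}) ⟩
      a * Z - b                     ≡⟨ ≡.cong (_- b) (ℤ.*-comm a Z) ⟩
      Z * a - b                     ∎
    lemma : ∀ a b Z → (Z * a - b) * Z - a ≡ (Z * Z - + 1) * a - Z * b
    lemma = solve-∀
    x′≡ : + proj₁ (f p (q₁ , q₂ , z)) ≡ₚ (Z * Z - + 1) * a - Z * b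
    x′≡ = begin
      + proj₁ (f p (q₁ , q₂ , z))   ≈⟨ %-minus-≡ₚ ((y′ ℕ.* z) % p) q₁ ⟩
      + ((y′ ℕ.* z) % p) - + q₁     ≈⟨ minus-congₚ (%-*-≡ₚ y′ z) q₁≡a ⟩
      + y′ * Z - a                  ≈⟨ minus-congₚ (*-congₚ y′≡ (≡ₚ-refl {Z})) (≡ₚ-refl {a}) ⟩
      (Z * a - b) * Z - a           ≡⟨ lemma a b Z ⟩
      (Z * Z - + 1) * a - Z * b     ∎

  represents-resp : ∀ {Q w w′} → Represents Q w → w ≈ w′ → Represents Q w′
  represents-resp (represents z≡ x≡ y≡) (a , b) = represents z≡ (≡ₚ-trans x≡ a) (≡ₚ-trans y≡ b)

  represents-fIter : ∀ n → Represents (fIter p n (x , y , z)) (act (ζ ^ n) v)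
  represents-fIter zero    = represents-resp (represents ≡.refl ≡ₚ-refl ≡ₚ-refl) (≈-sym (act-1 v))
  represents-fIter (suc n) = represents-resp (represents-f (represents-fIter n)) (≈-sym (act-ζ⊗ (ζ ^ n) v))

  periodic⇒act-fixes : ∀ N → fIter p N (x , y , z) ≡ (x , y , z) → act (ζ ^ N) v ≈ v
  periodic⇒act-fixes N fixed = ≡ₚ-sym (x-coordinate fixed-rep) , ≡ₚ-sym (y-coordinate fixed-rep)
    where
    open Represents
    fixed-rep : Represents (x , y , z) (act (ζ ^ N) v)
    fixed-rep = ≡.subst (λ Q → Represents Q (act (ζ ^ N) v)) fixed (represents-fIter N)

  module _ (x<p : x < p) (y<p : y < p) where

    residues : ∀ n → proj₁ (fIter p n (x , y , z)) < p × proj₁ (proj₂ (fIter p n (x , y , z))) < p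
    residues zero    = x<p , y<p
    residues (suc n) = m%n<n _ p , m%n<n _ p

    ζ^N≈1⇒periodic : ∀ N → ζ ^ N ≈ 1# → fIter p N (x , y , z) ≡ (x , y , z)
    ζ^N≈1⇒periodic N ζ^N≈1 =
      cong₂ _,_ (≡ₚ⇒≡ (proj₁ (residues N)) x<p (x-coordinate rep))
                (cong₂ _,_ (≡ₚ⇒≡ (proj₂ (residues N)) y<p (y-coordinate rep)) (z-coordinate rep))
      where
      open Represents
      rep : Represents (fIter p N (x , y , z)) v
      rep = represents-resp (represents-fIter N) (≈-trans (act-cong ζ^N≈1 (≈-refl {v})) (act-1 v))

  -- Multiply (B − 1) v ≡ 0 by the adjugate of the matrix of B − 1, whose determinant is norm (B − 1).
  act-fixes⇒p∣norm·v : ∀ {b₁ b₂} → act (b₁ , b₂) v ≈ v →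
    p∣ norm (b₁ - + 1 , b₂) * X × p∣ norm (b₁ - + 1 , b₂) * Y
  act-fixes⇒p∣norm·v {b₁} {b₂} (fixes₁ , fixes₂) =
    ∣-respʳ (adjugate₁ m b₂ X Y Z) (∣m∣n⇒∣m+n (∣n⇒∣m*n (m - b₂) p∣row₁) (∣n⇒∣m*n (b₂ * Z) p∣row₂)) ,
    ∣-respʳ (adjugate₂ m b₂ X Y Z) (∣m∣n⇒∣m+n (∣n⇒∣m*n (- (b₂ * Z)) p∣row₁) (∣n⇒∣m*n (m + b₂ * (Z * Z - + 1)) p∣row₂))
    where
    m : ℤ
    m = b₁ - + 1
    lemma : ∀ b₁ b₂ w Tw → b₁ * w + b₂ * Tw - w ≡ (b₁ - + 1) * w + b₂ * Tw
    lemma = solve-∀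
    p∣row₁ : p∣ m * X + b₂ * ((Z * Z - + 1) * X - Z * Y)
    p∣row₁ = ∣-respʳ (lemma b₁ b₂ X _) (p∣difference fixes₁)
    p∣row₂ : p∣ m * Y + b₂ * (Z * X - Y)
    p∣row₂ = ∣-respʳ (lemma b₁ b₂ Y _) (p∣difference fixes₂)
    adjugate₁ : ∀ m b X Y Z →
      (m - b) * (m * X + b * ((Z * Z - + 1) * X - Z * Y)) + (b * Z) * (m * Y + b * (Z * X - Y))
                              ≡ (m * m + m * b * (Z * Z - + 2) + b * b) * X
    adjugate₁ = solve-∀
    adjugate₂ : ∀ m b X Y Z →
      (- (b * Z)) * (m * X + b * ((Z * Z - + 1) * X - Z * Y)) + (m + b * (Z * Z - + 1)) * (m * Y + b * (Z * X - Y))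
                              ≡ (m * m + m * b * (Z * Z - + 2) + b * b) * Y
    adjugate₂ = solve-∀

module MarkoffPoint (p : ℕ) .{{_ : NonZero p}} (p-prime : Prime p) {ℓ} (p≡24ℓ+19 : p ≡ 24 ℕ.* ℓ ℕ.+ 19)
                    (x y z : ℕ) (P∈M : InM p (x , y , z)) (P≢0 : ¬ (x , y , z) ≡ (0 , 0 , 0))
                    (z²≢1 : ¬ (z ℕ.* z) % p ≡ 1 % p) where
  open import Data.Integer using (+_; -_; _+_; _-_; _*_)

  open IntegersModPrime p p-prime hiding (_^_; ^-congˡ; ^-congʳ; ^-homo-*; ^-distrib-*)
  open MarkoffOrbit p p-prime x y z

  k : ℕ
  k = 12 ℕ.* ℓ ℕ.+ 9

  p≡2k+1 : p ≡ suc (k ℕ.+ k)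
  p≡2k+1 = ≡.trans p≡24ℓ+19 (lemma ℓ)
    where lemma : ∀ ℓ → 24 ℕ.* ℓ ℕ.+ 19 ≡ suc ((12 ℕ.* ℓ ℕ.+ 9) ℕ.+ (12 ℕ.* ℓ ℕ.+ 9))
          lemma = ℕ-Solver.solve-∀

  [p-1][p+1]≡[p²-1]/24*24 : (k ℕ.+ k) ℕ.* suc (suc (k ℕ.+ k)) ≡ (p ℕ.* p ℕ.∸ 1) / 24 ℕ.* 24
  [p-1][p+1]≡[p²-1]/24*24 = begin
    (k ℕ.+ k) ℕ.* suc (suc (k ℕ.+ k))      ≡⟨ lemma₁ ℓ ⟩
    K ℕ.* 24                               ≡⟨ ≡.cong (ℕ._* 24) (m*n/n≡m K 24) ⟨
    K ℕ.* 24 / 24 ℕ.* 24                   ≡⟨ ≡.cong (λ m → (m ℕ.∸ 1) / 24 ℕ.* 24) (lemma₂ ℓ) ⟨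
    (P ℕ.* P ℕ.∸ 1) / 24 ℕ.* 24            ≡⟨ ≡.cong (λ q → (q ℕ.* q ℕ.∸ 1) / 24 ℕ.* 24) p≡24ℓ+19 ⟨
    (p ℕ.* p ℕ.∸ 1) / 24 ℕ.* 24            ∎
    where
    open ≡.≡-Reasoning
    P K : ℕ
    P = 24 ℕ.* ℓ ℕ.+ 19
    K = 24 ℕ.* (ℓ ℕ.* ℓ) ℕ.+ 38 ℕ.* ℓ ℕ.+ 15
    lemma₁ : ∀ ℓ → (12 ℕ.* ℓ ℕ.+ 9 ℕ.+ (12 ℕ.* ℓ ℕ.+ 9)) ℕ.* suc (suc (12 ℕ.* ℓ ℕ.+ 9 ℕ.+ (12 ℕ.* ℓ ℕ.+ 9)))
                 ≡ (24 ℕ.* (ℓ ℕ.* ℓ) ℕ.+ 38 ℕ.* ℓ ℕ.+ 15) ℕ.* 24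
    lemma₁ = ℕ-Solver.solve-∀
    lemma₂ : ∀ ℓ → (24 ℕ.* ℓ ℕ.+ 19) ℕ.* (24 ℕ.* ℓ ℕ.+ 19) ≡
                   suc ((24 ℕ.* (ℓ ℕ.* ℓ) ℕ.+ 38 ℕ.* ℓ ℕ.+ 15) ℕ.* 24)
    lemma₂ = ℕ-Solver.solve-∀

  p≡4m+3 : p ≡ 4 ℕ.* (6 ℕ.* ℓ ℕ.+ 4) ℕ.+ 3
  p≡4m+3 = ≡.trans p≡24ℓ+19 (lemma ℓ)
    where lemma : ∀ ℓ → 24 ℕ.* ℓ ℕ.+ 19 ≡ 4 ℕ.* (6 ℕ.* ℓ ℕ.+ 4) ℕ.+ 3
          lemma = ℕ-Solver.solve-∀

  p≡8m+3 : p ≡ 8 ℕ.* (3 ℕ.* ℓ ℕ.+ 2) ℕ.+ 3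
  p≡8m+3 = ≡.trans p≡24ℓ+19 (lemma ℓ)
    where lemma : ∀ ℓ → 24 ℕ.* ℓ ℕ.+ 19 ≡ 8 ℕ.* (3 ℕ.* ℓ ℕ.+ 2) ℕ.+ 3
          lemma = ℕ-Solver.solve-∀

  p≡12m+7 : p ≡ 12 ℕ.* (2 ℕ.* ℓ ℕ.+ 1) ℕ.+ 7
  p≡12m+7 = ≡.trans p≡24ℓ+19 (lemma ℓ)
    where lemma : ∀ ℓ → 24 ℕ.* ℓ ℕ.+ 19 ≡ 12 ℕ.* (2 ℕ.* ℓ ℕ.+ 1) ℕ.+ 7
          lemma = ℕ-Solver.solve-∀

  open MinusOneNonresidue p p-prime {6 ℕ.* ℓ ℕ.+ 4} p≡4m+3 using (sum-of-squares)
  open TwoNonresidue p p-prime {3 ℕ.* ℓ ℕ.+ 2} p≡8m+3 using (2-nonresidue)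
  open ThreeNonresidue p p-prime {2 ℕ.* ℓ ℕ.+ 1} p≡12m+7 using (3-nonresidue)

  x<p : x < p
  x<p = proj₁ (proj₁ P∈M)
  y<p : y < p
  y<p = proj₁ (proj₂ (proj₁ P∈M))
  z<p : z < p
  z<p = proj₂ (proj₂ (proj₁ P∈M))

  p∣surface : p∣ X * X + Y * Y + Z * Z - X * Y * Z
  p∣surface = p∣difference (begin
    X * X + Y * Y + Z * Z                     ≡⟨ lhs≡ ⟨
    + (x ℕ.* x ℕ.+ y ℕ.* y ℕ.+ z ℕ.* z)       ≈⟨ %-≡ₚ _ ⟨
    + ((x ℕ.* x ℕ.+ y ℕ.* y ℕ.+ z ℕ.* z) % p) ≡⟨ ≡.cong +_ (proj₂ P∈M) ⟩
    + ((x ℕ.* y ℕ.* z) % p)                   ≈⟨ %-≡ₚ _ ⟩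
    + (x ℕ.* y ℕ.* z)                         ≡⟨ rhs≡ ⟩
    X * Y * Z                                 ∎)
    where
    open import Relation.Binary.Reasoning.Setoid (CommutativeRing.setoid ℤₚ)
    lhs≡ : + (x ℕ.* x ℕ.+ y ℕ.* y ℕ.+ z ℕ.* z) ≡ X * X + Y * Y + Z * Z
    lhs≡ = ≡.trans (ℤ.pos-+ (x ℕ.* x ℕ.+ y ℕ.* y) (z ℕ.* z))
             (cong₂ _+_ (≡.trans (ℤ.pos-+ (x ℕ.* x) (y ℕ.* y)) (cong₂ _+_ (ℤ.pos-* x x) (ℤ.pos-* y y))) (ℤ.pos-* z z))
    rhs≡ : + (x ℕ.* y ℕ.* z) ≡ X * Y * Z
    rhs≡ = ≡.trans (ℤ.pos-* (x ℕ.* y) z) (≡.cong (_* Z) (ℤ.pos-* x y))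

  p∤2 : ¬ p∣ + 2
  p∤2 = p∤-below (≡.subst (19 ℕ.≤_) (≡.sym p≡24ℓ+19) (ℕ.m≤n+m 19 _)) (s≤s z≤n) (s≤s (s≤s (s≤s z≤n)))

  p∣⇒≡0 : ∀ {a} → a < p → p∣ + a → a ≡ 0
  p∣⇒≡0 a<p p∣a = ≡ₚ⇒≡ a<p (ℕ.>-nonZero⁻¹ p) (p∣⇒≡ₚ0 p∣a)

  p∣Z : p∣ X → p∣ Y → p∣ Z
  p∣Z p∣X p∣Y = p∣square⇒p∣ Z (∣-respʳ (lemma X Y Z)
    (∣m∣n⇒∣m+n (∣m∣n⇒∣m+n (∣m∣n⇒∣m+n p∣surface (∣n⇒∣m*n (- X) p∣X)) (∣n⇒∣m*n (- Y) p∣Y))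
                (∣n⇒∣m*n (Y * Z) p∣X)))
    where lemma : ∀ X Y Z → X * X + Y * Y + Z * Z - X * Y * Z + (- X) * X + (- Y) * Y + (Y * Z) * X ≡ Z * Z
          lemma = solve-∀

  ¬p∣X×p∣Y : p∣ X → p∣ Y → ⊥
  ¬p∣X×p∣Y p∣X p∣Y = P≢0 (cong₂ _,_ (p∣⇒≡0 x<p p∣X) (cong₂ _,_ (p∣⇒≡0 y<p p∣Y) (p∣⇒≡0 z<p (p∣Z p∣X p∣Y))))

  p∤t+2 : ¬ p∣ t + + 2
  p∤t+2 p∣t+2 = ¬p∣X×p∣Y (sum-of-squares Y X (∣-respʳ (ℤ.+-comm (X * X) (Y * Y)) p∣X²+Y²))
                         (sum-of-squares X Y p∣X²+Y²)
    where
    lemma₁ : ∀ Z → Z * Z - + 2 + + 2 ≡ Z * Z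
    lemma₁ = solve-∀
    p∣Z′ : p∣ Z
    p∣Z′ = p∣square⇒p∣ Z (∣-respʳ (lemma₁ Z) p∣t+2)
    lemma₂ : ∀ X Y Z → X * X + Y * Y + Z * Z - X * Y * Z + (- Z) * Z + (X * Y) * Z ≡ X * X + Y * Y
    lemma₂ = solve-∀
    p∣X²+Y² : p∣ X * X + Y * Y
    p∣X²+Y² = ∣-respʳ (lemma₂ X Y Z)
      (∣m∣n⇒∣m+n (∣m∣n⇒∣m+n p∣surface (∣n⇒∣m*n (- Z) p∣Z′)) (∣n⇒∣m*n (X * Y) p∣Z′))

  p∤t-2 : ¬ p∣ t - + 2
  p∤t-2 p∣t-2 = p∤2 (p∣square⇒p∣ (+ 2) (sum-of-squares (+ 2 * X - Z * Y) (+ 4)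
                 (∣-respʳ (lemma X Y Z) (∣m∣n⇒∣m+n (∣n⇒∣m*n (+ 4) p∣surface) (∣n⇒∣m*n (Y * Y - + 4) p∣t-2)))))
    where lemma : ∀ X Y Z → + 4 * (X * X + Y * Y + Z * Z - X * Y * Z) + (Y * Y - + 4) * (Z * Z - + 2 - + 2) ≡
                            (+ 2 * X - Z * Y) * (+ 2 * X - Z * Y) + + 4 * + 4
          lemma = solve-∀

  p∤t+1 : ¬ p∣ t + + 1
  p∤t+1 p∣t+1 =
    z²≢1 (≡ₚ⇒≡ (m%n<n _ p) (m%n<n 1 p) (≡ₚ-trans (%-≡ₚ (z ℕ.* z)) (≡ₚ-trans z²≡1 (≡ₚ-sym (%-≡ₚ 1)))))
    where lemma : ∀ Z → Z * Z - + 2 + + 1 ≡ Z * Z - + 1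
          lemma = solve-∀
          z²≡1 : + (z ℕ.* z) ≡ₚ + 1
          z²≡1 = mk≡ₚ (∣-respʳ (≡.trans (lemma Z) (≡.cong (_- + 1) (≡.sym (ℤ.pos-* z z)))) p∣t+1)

  p∤t : ¬ p∣ t
  p∤t = 2-nonresidue Z

  p∤t-1 : ¬ p∣ t - + 1
  p∤t-1 p∣t-1 = 3-nonresidue Z (∣-respʳ (lemma Z) p∣t-1)
    where lemma : ∀ Z → Z * Z - + 2 - + 1 ≡ Z * Z - + 3
          lemma = solve-∀

  p∤t²-4 : ¬ p∣ t * t - + 4
  p∤t²-4 p∣t²-4 = [ p∤t-2 , p∤t+2 ]′ (euclidsLemmaₚ (t - + 2) (t + + 2) (∣-respʳ (lemma t) p∣t²-4))
    where lemma : ∀ t → t * t - + 4 ≡ (t - + 2) * (t + + 2)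
          lemma = solve-∀

  p∤2-[u²-2] : ∀ u → ¬ p∣ + 2 - u → ¬ p∣ + 2 + u → ¬ p∣ + 2 - (u * u - + 2)
  p∤2-[u²-2] u p∤2-u p∤2+u p∣ = [ p∤2-u , p∤2+u ]′ (euclidsLemmaₚ (+ 2 - u) (+ 2 + u) (∣-respʳ (lemma u) p∣))
    where lemma : ∀ u → + 2 - (u * u - + 2) ≡ (+ 2 - u) * (+ 2 + u)
          lemma = solve-∀

  p∤2+[u²-2] : ∀ u → ¬ p∣ u → ¬ p∣ + 2 + (u * u - + 2)
  p∤2+[u²-2] u p∤u p∣ = p∤u (p∣square⇒p∣ u (∣-respʳ (lemma u) p∣))
    where lemma : ∀ u → + 2 + (u * u - + 2) ≡ u * u
          lemma = solve-∀

  p∤2-trace[ζ²⁴] : ¬ p∣ + 2 - trace (ζ ^ 24)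
  p∤2-trace[ζ²⁴] p∣2-trace =
    p∤2-u₂₄ (∣-respʳ (lemma (trace (ζ ^ 24)) _) (∣m∣n⇒∣m+n p∣2-trace (p∣difference trace≡u₂₄)))
    where
    w u₆ u₁₂ : ℤ
    w   = t * t * t - + 3 * t
    u₆  = w * w - + 2
    u₁₂ = u₆ * u₆ - + 2
    trace≡u₂₄ : trace (ζ ^ 24) ≡ₚ u₁₂ * u₁₂ - + 2
    trace≡u₂₄ = trace-ζ^[n+n] 12 (trace-ζ^[n+n] 6 (trace-ζ^[n+n] 3 trace-ζ³))
    lemma : ∀ a b → + 2 - a + (a - b) ≡ + 2 - b
    lemma = solve-∀
    p∤w : ¬ p∣ w
    p∤w p∣w = [ p∤t , 3-nonresidue t ]′ (euclidsLemmaₚ t (t * t - + 3) (∣-respʳ (lemma′ t) p∣w))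
      where lemma′ : ∀ t → t * t * t - + 3 * t ≡ t * (t * t - + 3)
            lemma′ = solve-∀
    p∤2-w : ¬ p∣ + 2 - w
    p∤2-w p∣ = [ (λ p∣2-t → p∤t-2 (∣-respʳ (lemma′ t) (∣m⇒∣-m p∣2-t)))
               , (λ p∣[t+1]² → p∤t+1 (p∣square⇒p∣ _ p∣[t+1]²)) ]′
                (euclidsLemmaₚ (+ 2 - t) ((t + + 1) * (t + + 1)) (∣-respʳ (lemma″ t) p∣))
      where lemma′ : ∀ t → - (+ 2 - t) ≡ t - + 2
            lemma′ = solve-∀
            lemma″ : ∀ t → + 2 - (t * t * t - + 3 * t) ≡ (+ 2 - t) * ((t + + 1) * (t + + 1))
            lemma″ = solve-∀
    p∤2+w : ¬ p∣ + 2 + w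
    p∤2+w p∣ = [ p∤t+2 , (λ p∣[t-1]² → p∤t-1 (p∣square⇒p∣ _ p∣[t-1]²)) ]′
                (euclidsLemmaₚ (t + + 2) ((t - + 1) * (t - + 1)) (∣-respʳ (lemma′ t) p∣))
      where lemma′ : ∀ t → + 2 + (t * t * t - + 3 * t) ≡ (t + + 2) * ((t - + 1) * (t - + 1))
            lemma′ = solve-∀
    p∤2-u₁₂ : ¬ p∣ + 2 - u₁₂
    p∤2-u₁₂ = p∤2-[u²-2] u₆ (p∤2-[u²-2] w p∤2-w p∤2+w) (p∤2+[u²-2] w p∤w)
    p∤2+u₁₂ : ¬ p∣ + 2 + u₁₂
    p∤2+u₁₂ = p∤2+[u²-2] u₆ (2-nonresidue w)
    p∤2-u₂₄ : ¬ p∣ + 2 - (u₁₂ * u₁₂ - + 2)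
    p∤2-u₂₄ = p∤2-[u²-2] u₁₂ p∤2-u₁₂ p∤2+u₁₂

  ¬act-ζ²⁴-fixes : ¬ act (ζ ^ 24) v ≈ v
  ¬act-ζ²⁴-fixes fixes =
    [ p∤norm , (λ p∣X → [ p∤norm , ¬p∣X×p∣Y p∣X ]′ (euclidsLemmaₚ (norm B-1) Y (proj₂ p∣norm·v))) ]′
      (euclidsLemmaₚ (norm B-1) X (proj₁ p∣norm·v))
    where
    b₁ b₂ : ℤ
    b₁ = proj₁ (ζ ^ 24)
    b₂ = proj₂ (ζ ^ 24)
    B-1 : ℤ × ℤ
    B-1 = (b₁ - + 1 , b₂)
    p∣norm·v : p∣ norm B-1 * X × p∣ norm B-1 * Y
    p∣norm·v = act-fixes⇒p∣norm·v {b₁} {b₂} fixes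
    lemma : ∀ b₁ b₂ t →
      (b₁ - + 1) * (b₁ - + 1) + (b₁ - + 1) * b₂ * t + b₂ * b₂ + - ((b₁ * b₁ + b₁ * b₂ * t + b₂ * b₂) - + 1) ≡
      + 2 - (+ 2 * b₁ + b₂ * t)
    lemma = solve-∀
    p∤norm : ¬ p∣ norm B-1
    p∤norm p∣ = p∤2-trace[ζ²⁴] (∣-respʳ (lemma b₁ b₂ t) (∣m∣n⇒∣m+n p∣ (∣m⇒∣-m (p∣difference (norm-ζ^ 24)))))

  module _ {n} (period : ExactPeriod p n (x , y , z)) where
    open Iteration p

    period∣p-1⊎p+1 : n ∣ k ℕ.+ k ⊎ n ∣ suc (suc (k ℕ.+ k))
    period∣p-1⊎p+1 = Sum.map (ζ^N≈1⇒period∣N (k ℕ.+ k)) (ζ^N≈1⇒period∣N (suc (suc (k ℕ.+ k))))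
                       (ζ^[p-1]≈1⊎ζ^[p+1]≈1 {k} p≡2k+1 p∤2 p∤t²-4)
      where
      ζ^N≈1⇒period∣N : ∀ N → ζ ^ N ≈ 1# → n ∣ N
      ζ^N≈1⇒period∣N N ζ^N≈1 = exactPeriod∣ {n} {N} {x , y , z} period (ζ^N≈1⇒periodic x<p y<p N ζ^N≈1)

    period∣[p²-1]/24*24 : n ∣ (p ℕ.* p ℕ.∸ 1) / 24 ℕ.* 24
    period∣[p²-1]/24*24 = ≡.subst (n ∣_) [p-1][p+1]≡[p²-1]/24*24
      ([ (λ n∣p-1 → ∣-trans n∣p-1 (m∣m*n (suc (suc (k ℕ.+ k)))))
       , (λ n∣p+1 → ∣-trans n∣p+1 (n∣m*n (k ℕ.+ k))) ]′ period∣p-1⊎p+1)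

    period∤24 : ¬ n ∣ 24
    period∤24 n∣24 =
      ¬act-ζ²⁴-fixes (periodic⇒act-fixes 24 (fIter-∣ {n} {24} {x , y , z} n∣24 (proj₁ (proj₂ period))))

prime-divisor : ∀ {n} → 1 < n → Σ ℕ λ q → Prime q × q ∣ n
prime-divisor {n} 1<n with factorise n {{ℕ.>-nonZero (ℕ.<-trans (s≤s z≤n) 1<n)}}
... | record { factors = [] ; isFactorisation = n≡1 } = contradiction n≡1 (ℕ.>⇒≢ 1<n)
... | record { factors = q ∷ qs ; isFactorisation = n≡q*qs ; factorsPrime = q-prime ∷ _ } =
  q , q-prime , divides (product qs) (≡.trans n≡q*qs (ℕ.*-comm q (product qs)))

smallestPrimeFactor≤ : ∀ {ω K m n} → SmallestPrimeFactor ω K → 0 < n → n ∣ K ℕ.* m → ¬ n ∣ m → ω ≤ n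
smallestPrimeFactor≤ {ω} {K} {m} {n} (_ , _ , ω-minimal) 0<n n∣Km n∤m with gcd n K in g≡
... | zero        = contradiction (gcd[m,n]≡0⇒m≡0 g≡) (ℕ.>⇒≢ 0<n)
... | suc zero    = contradiction (coprime-divisor (gcd≡1⇒coprime g≡) n∣Km) n∤m
... | suc (suc g) with prime-divisor {suc (suc g)} (s≤s (s≤s z≤n))
...   | q , q-prime , q∣g = ℕ.≤-trans
  (ω-minimal q q-prime (∣-trans q∣g (≡.subst (_∣ K) g≡ (gcd[m,n]∣n n K))))
  (∣⇒≤ {{ℕ.>-nonZero 0<n}} (∣-trans q∣g (≡.subst (_∣ n) g≡ (gcd[m,n]∣m n K))))

open import Data.Nat using (_+_; _*_; _∸_)

lemma4p2 : (p ℓ : ℕ) → .{{_ : NonZero p}} → Prime p → 5 ≤ p → p ≡ 24 * ℓ + 19 →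
    (ω : ℕ) → SmallestPrimeFactor ω ((p * p ∸ 1) / 24) →
    (x y z : ℕ) → InM p (x , y , z) →
    ¬ ((x , y , z) ≡ (0 , 0 , 0)) →
    ¬ ((z * z) % p ≡ 1 % p) →
    (n : ℕ) → ExactPeriod p n (x , y , z) →
    ω ≤ n
lemma4p2 p ℓ p-prime _ p≡24ℓ+19 ω ω-smallest x y z P∈M P≢0 z²≢1 n period =
  smallestPrimeFactor≤ ω-smallest (proj₁ period) (period∣[p²-1]/24*24 period) (period∤24 period)
  where open MarkoffPoint p p-prime {ℓ} p≡24ℓ+19 x y z P∈M P≢0 z²≢1
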